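{- Let $e \geqslant 3$ be an integer and $m=e+1+\nu_2(e!)$. Then the disjoint union $P_{e-1}\cup (2^m-1)P_{e-1+2^m}$ is an $e$-lift graph of type II.
   Context: $\nu_2$ is the $2$-adic valuation. $P_N$ is the path graph on vertices $\{0,\dots,N-1\}$ with $i$ adjacent to $i+1$; $d\Gamma$ denotes the disjoint union of $d$ copies of a graph $\Gamma$. $A(\Gamma)$ is the adjacency matrix, $\operatorname{Char}_{A}(x)=\det(xI-A)$, $\mathsf c_k(p)$ is the coefficient of $x^{\deg p-k}$ in a polynomial $p$, and $\mathbf 1$ is the all-ones vector. For a positive integer $e$, a graph $\Gamma$ is an $e$-lift graph of type II if (a) for each $k\in\{0,1,\dots,e\}$, $\mathbf 1^\top A(\Gamma)^k\mathbf 1\equiv 0\pmod{2^{e+2-k}}$ when $k\neq e$ and $\mathbf 1^\top A(\Gamma)^e\mathbf 1\equiv 2\pmod{4}$; and (b) $2^{e+2-k}$ divides $\mathsf c_k(\operatorname{Char}_{A(\Gamma)})$ for each $k\in\{1,2,\dots,e+1\}$. -}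

module Defs where

open import Data.Nat as ℕ using (ℕ; zero; suc; _≤_; _<_; _∸_; _≡ᵇ_; _≤ᵇ_)
open import Data.Nat.DivMod using (_%_; _/_)
open import Data.Integer as ℤ using (ℤ; +_; 0ℤ; 1ℤ; -_)
open import Data.Integer.Divisibility using (_∣_)
open import Data.Fin using (Fin; zero; suc; toℕ; splitAt; punchIn; _≟_)
open import Data.Bool using (Bool; true; false; if_then_else_; _∨_; _∧_)
open import Data.List using (List; []; _∷_; map)
open import Data.Sum using (inj₁; inj₂)
open import Data.Product using (_×_)
open import Relation.Nullary using (¬_; does)
open import Relation.Binary.PropositionalEquality using (_≡_)

-- 2-adic valuation (ν₂ n for n ≥ 1; ν₂ 0 = 0 by convention, irrelevant here)

ν₂-aux : ℕ → ℕ → ℕ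
ν₂-aux zero    n = 0
ν₂-aux (suc f) n with n ≡ᵇ 0 | n % 2 ≡ᵇ 0
... | false | true = suc (ν₂-aux f (n / 2))
... | _     | _    = 0

ν₂ : ℕ → ℕ
ν₂ n = ν₂-aux n n

record Graph : Set where
  field
    size : ℕ
    adj  : Fin size → Fin size → Bool
open Graph public

P : ℕ → Graph
size (P N) = N
adj  (P N) i j = (toℕ j ≡ᵇ suc (toℕ i)) ∨ (toℕ i ≡ᵇ suc (toℕ j))

_⊕_ : Graph → Graph → Graph
size (Γ ⊕ Δ) = size Γ ℕ.+ size Δ
adj  (Γ ⊕ Δ) i j with splitAt (size Γ) i | splitAt (size Γ) j
... | inj₁ a | inj₁ b = adj Γ a b
... | inj₂ a | inj₂ b = adj Δ a b
... | _      | _      = false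

emptyGraph : Graph
size emptyGraph = 0
adj  emptyGraph () _

copies : ℕ → Graph → Graph
copies zero    Γ = emptyGraph
copies (suc d) Γ = Γ ⊕ copies d Γ

Mat : ℕ → Set
Mat n = Fin n → Fin n → ℤ

sumFin : ∀ {n} → (Fin n → ℤ) → ℤ
sumFin {zero}  f = 0ℤ
sumFin {suc n} f = f zero ℤ.+ sumFin (λ i → f (suc i))

b2z : Bool → ℤ
b2z true  = 1ℤ
b2z false = 0ℤ

A : (Γ : Graph) → Mat (size Γ)
A Γ i j = b2z (adj Γ i j)

idMat : ∀ {n} → Mat n
idMat i j = if does (i ≟ j) then 1ℤ else 0ℤ

_⊗_ : ∀ {n} → Mat n → Mat n → Mat n
(M ⊗ N) i j = sumFin (λ k → M i k ℤ.* N k j)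

_^M_ : ∀ {n} → Mat n → ℕ → Mat n
M ^M zero  = idMat
M ^M suc k = M ⊗ (M ^M k)

oneMone : ∀ {n} → Mat n → ℤ
oneMone M = sumFin (λ i → sumFin (λ j → M i j))

-- Integer polynomials as little-endian coefficient lists

Poly : Set
Poly = List ℤ

_+P_ : Poly → Poly → Poly
[]      +P q       = q
(a ∷ p) +P []      = a ∷ p
(a ∷ p) +P (b ∷ q) = (a ℤ.+ b) ∷ (p +P q)

_*P_ : Poly → Poly → Poly
[]      *P q = []
(a ∷ p) *P q = map (a ℤ.*_) q +P (0ℤ ∷ (p *P q))

negP : Poly → Poly
negP = map -_

coeff : Poly → ℕ → ℤ
coeff []      _       = 0ℤ
coeff (a ∷ p) zero    = a
coeff (a ∷ p) (suc i) = coeff p i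

isZeroP : Poly → Bool
isZeroP []      = true
isZeroP (a ∷ p) = (ℤ.∣ a ∣ ≡ᵇ 0) ∧ isZeroP p

-- degree (deg of the zero polynomial taken to be 0)
deg : Poly → ℕ
deg []      = 0
deg (a ∷ p) = if isZeroP p then 0 else suc (deg p)

c : ℕ → Poly → ℤ
c k p = if k ≤ᵇ deg p then coeff p (deg p ∸ k) else 0ℤ

sumP : ∀ {n} → (Fin n → Poly) → Poly
sumP {zero}  f = []
sumP {suc n} f = f zero +P sumP (λ i → f (suc i))

det : ∀ {n} → (Fin n → Fin n → Poly) → Poly
det {zero}  M = 1ℤ ∷ []
det {suc n} M = sumP (λ j → sgn (toℕ j) (M zero j *P det (λ i k → M (suc i) (punchIn j k))))
  where
  sgn : ℕ → Poly → Poly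
  sgn zero          p = p
  sgn (suc zero)    p = negP p
  sgn (suc (suc t)) p = sgn t p

-- Char_M(x) = det(xI - M)
Char : ∀ {n} → Mat n → Poly
Char M = det (λ i j → if does (i ≟ j) then (- M i j) ∷ 1ℤ ∷ [] else (- M i j) ∷ [])

_≡₂mod4 : ℤ → Set
x ≡₂mod4 = + 4 ∣ (x ℤ.- + 2)

IsLiftGraphII : ℕ → Graph → Set
IsLiftGraphII e Γ =
  ( (∀ k → k ≤ e → ¬ (k ≡ e) → (+ (2 ℕ.^ (e ℕ.+ 2 ∸ k))) ∣ oneMone (A Γ ^M k))
  × oneMone (A Γ ^M e) ≡₂mod4 )
  × (∀ k → 1 ≤ k → k ≤ e ℕ.+ 1 → (+ (2 ℕ.^ (e ℕ.+ 2 ∸ k))) ∣ c k (Char (A Γ)))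

{-# OPTIONS --safe #-}
module Submission where

-- Write a = e - 1, N = a + 2^m and d = 2^m - 1, so the graph is P a ⊕ d·P N and its
-- adjacency matrix is block diagonal.
--
-- (a) 1ᵀA^k1 counts walks of length k. Appending a vertex to a path with at least k
-- vertices adds exactly 2^k walks of length k, so for k ≤ a the d long components
-- contribute d·(W_k(a) + 2^m·2^k) and the total is a multiple of 2^m, where
-- m ≥ e + 2 because e! is even. For k = e the short component P a has 2 walks more
-- than this pattern predicts, which leaves the residue 2 modulo 4.
--
-- (b) Char = p_a · p_N^d for the path polynomials p. The scaled reversal
-- r(y) = (2y)^D p(1/(2y)) is multiplicative and multiplies c_k by 2^k, so it
-- suffices that r_a · r_N^d ≡ 1 modulo 2^(e+2). The reversed path polynomials
-- satisfy r_(N+2) = r_(N+1) - 4y² r_N, whence r_N ≡ 1 (mod 4), so r_N^(2^m) ≡ 1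
-- (mod 2^(m+2)) by repeated squaring; and their coefficients (-4)^j C(N-j, j)
-- together with 2^j C(x + 2^m, j) ≡ 2^j C(x, j) (mod 2^m) give r_a ≡ r_N (mod 2^(e+2)).

open import Defs
open import Data.Bool using (Bool; true; false; if_then_else_; T)
open import Data.Fin as Fin using (Fin; toℕ; punchIn; _↑ˡ_; _↑ʳ_) renaming (zero to fzero; suc to fsuc)
import Data.Fin.Properties as FinP
open import Data.Integer as ℤ using (ℤ; +_; 0ℤ; 1ℤ; -_; _+_; _*_; _-_; +0; +[1+_]; -[1+_])
open import Data.Integer.Divisibility using () renaming (_∣_ to _∣ᵤ_)
open import Data.Integer.Divisibility.Signed as ℤ∣ using (divides) renaming (_∣_ to _∣ℤ_)
import Data.Integer.Properties as ℤP
open import Data.Integer.Tactic.RingSolver using (solve-∀)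
open import Data.List using ([]; _∷_; map; applyUpTo)
open import Data.Nat as ℕ using (ℕ; zero; suc; _≤_; _<_; _∸_; _^_; _!; z≤n; s≤s)
open import Data.Nat.Combinatorics using (_C_; nC1≡n; nCk+nC[k+1]≡[n+1]C[k+1]; k>n⇒nCk≡0)
open import Data.Nat.Divisibility as ℕ∣ using (_∣_; divides)
open import Data.Nat.DivMod using (_%_)
open import Data.Nat.Induction using (<-rec)
import Data.Nat.Properties as ℕP
open import Data.Nat.Tactic.RingSolver renaming (solve-∀ to ℕ-solve-∀)
open import Data.Product using (_,_)
open import Data.Sum using ([_,_]′; inj₁; inj₂)
open import Data.Unit using (tt)
open import Function using (_∘_; flip)
open import Function.Bundles using (mk⇔)
open import Relation.Binary.Bundles using (Setoid)
open import Relation.Binary.PropositionalEquality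
import Relation.Binary.Reasoning.Setoid
open import Relation.Nullary using (yes; no; does; contradiction)
open import Relation.Nullary.Decidable using (does-⇔; dec-false; dec-true)
open import Algebra.Properties.CommutativeSemigroup ℤP.*-commutativeSemigroup using (x∙yz≈y∙xz)
import Algebra.Properties.Semiring.Sum ℕP.+-*-semiring as ℕΣ
open import Algebra.Properties.Semiring.Sum ℤP.+-*-semiring
  using (sum; sum-cong-≗; sum-replicate-zero; ∑-distrib-+; *-distribˡ-sum; ∑-comm)

sumFin≡sum : ∀ {n} (f : Fin n → ℤ) → sumFin f ≡ sum f
sumFin≡sum {zero}  f = refl
sumFin≡sum {suc n} f = cong (_+_ (f fzero)) (sumFin≡sum (f ∘ fsuc))

sum-zero : ∀ {n} (f : Fin n → ℤ) → (∀ i → f i ≡ 0ℤ) → sum f ≡ 0ℤ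
sum-zero {n} f f≡0 = trans (sum-cong-≗ f≡0) (sum-replicate-zero n)

sum-↑ : ∀ a {b} (f : Fin (a ℕ.+ b) → ℤ) → sum f ≡ sum (f ∘ (_↑ˡ b)) + sum (f ∘ (a ↑ʳ_))
sum-↑ zero    f = sym (ℤP.+-identityˡ _)
sum-↑ (suc a) f = trans (cong (_+_ (f fzero)) (sum-↑ a (f ∘ fsuc))) (sym (ℤP.+-assoc (f fzero) _ _))

∣-sum : ∀ {m n} (f : Fin n → ℤ) → (∀ i → m ∣ℤ f i) → m ∣ℤ sum f
∣-sum {m} {zero}  f m∣f = divides 0ℤ refl
∣-sum {m} {suc n} f m∣f = ℤ∣.∣m∣n⇒∣m+n (m∣f fzero) (∣-sum (f ∘ fsuc) (m∣f ∘ fsuc))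

sum-+ : ∀ {n} (f : Fin n → ℕ) → sum (λ i → + f i) ≡ + ℕΣ.sum f
sum-+ {zero}  f = refl
sum-+ {suc n} f = trans (cong (_+_ (+ f fzero)) (sum-+ (f ∘ fsuc))) (sym (ℤP.pos-+ (f fzero) _))

∑-distrib-- : ∀ {n} (f g : Fin n → ℤ) → sum f - sum g ≡ sum (λ i → f i - g i)
∑-distrib-- {zero}  f g = refl
∑-distrib-- {suc n} f g = trans (lemma (f fzero) (g fzero) (sum (f ∘ fsuc)) (sum (g ∘ fsuc)))
                          (cong (_+_ (f fzero - g fzero)) (∑-distrib-- (f ∘ fsuc) (g ∘ fsuc)))
  where
  lemma : ∀ a b s t → (a + s) - (b + t) ≡ (a - b) + (s - t)
  lemma = solve-∀

infix 4 _≈_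
record _≈_ (p q : Poly) : Set where
  constructor coeffwise
  field coeff-≡ : ∀ i → coeff p i ≡ coeff q i
open _≈_ public

≈-refl : ∀ {p} → p ≈ p
≈-refl = coeffwise λ _ → refl

≈-sym : ∀ {p q} → p ≈ q → q ≈ p
≈-sym p≈q = coeffwise λ i → sym (coeff-≡ p≈q i)

≈-trans : ∀ {p q r} → p ≈ q → q ≈ r → p ≈ r
≈-trans p≈q q≈r = coeffwise λ i → trans (coeff-≡ p≈q i) (coeff-≡ q≈r i)

≡⇒≈ : ∀ {p q} → p ≡ q → p ≈ q
≡⇒≈ refl = ≈-refl

≈-setoid : Setoid _ _
≈-setoid = record
  { Carrier = Poly ; _≈_ = _≈_
  ; isEquivalence = record { refl = ≈-refl ; sym = ≈-sym ; trans = ≈-trans } }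

module ≈-Reasoning = Relation.Binary.Reasoning.Setoid ≈-setoid

_·P_ : ℤ → Poly → Poly
a ·P p = map (a *_) p

1P : Poly
1P = 1ℤ ∷ []

convolution : Poly → Poly → (n : ℕ) → Fin (suc n) → ℤ
convolution p q n i = coeff p (toℕ i) * coeff q (n ∸ toℕ i)

coeff-+P : ∀ p q i → coeff (p +P q) i ≡ coeff p i + coeff q i
coeff-+P []      q       i       = sym (ℤP.+-identityˡ _)
coeff-+P (a ∷ p) []      i       = sym (ℤP.+-identityʳ _)
coeff-+P (a ∷ p) (b ∷ q) zero    = refl
coeff-+P (a ∷ p) (b ∷ q) (suc i) = coeff-+P p q i

coeff-·P : ∀ a p i → coeff (a ·P p) i ≡ a * coeff p i
coeff-·P a []      i       = sym (ℤP.*-zeroʳ a)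
coeff-·P a (b ∷ p) zero    = refl
coeff-·P a (b ∷ p) (suc i) = coeff-·P a p i

coeff-negP : ∀ p i → coeff (negP p) i ≡ - coeff p i
coeff-negP []      i       = refl
coeff-negP (a ∷ p) zero    = refl
coeff-negP (a ∷ p) (suc i) = coeff-negP p i

coeff-+P-negP : ∀ p q i → coeff (p +P negP q) i ≡ coeff p i - coeff q i
coeff-+P-negP p q i = trans (coeff-+P p (negP q) i) (cong (_+_ (coeff p i)) (coeff-negP q i))

coeff-*P : ∀ p q n → coeff (p *P q) n ≡ sum (convolution p q n)
coeff-*P []      q n       = sym (sum-zero (convolution [] q n) λ i → ℤP.*-zeroˡ (coeff q (n ∸ toℕ i)))
coeff-*P (a ∷ p) q zero    = trans (coeff-+P (a ·P q) _ 0) (cong (_+ 0ℤ) (coeff-·P a q 0))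
coeff-*P (a ∷ p) q (suc n) =
  trans (coeff-+P (a ·P q) _ (suc n)) (cong₂ _+_ (coeff-·P a q (suc n)) (coeff-*P p q n))

+P-cong : ∀ {p p′ q q′} → p ≈ p′ → q ≈ q′ → (p +P q) ≈ (p′ +P q′)
+P-cong {p} {p′} {q} {q′} p≈p′ q≈q′ = coeffwise λ i → begin
  coeff (p +P q) i       ≡⟨ coeff-+P p q i ⟩
  coeff p i + coeff q i   ≡⟨ cong₂ _+_ (coeff-≡ p≈p′ i) (coeff-≡ q≈q′ i) ⟩
  coeff p′ i + coeff q′ i ≡⟨ coeff-+P p′ q′ i ⟨
  coeff (p′ +P q′) i     ∎
  where open ≡-Reasoning

negP-cong : ∀ {p q} → p ≈ q → negP p ≈ negP q
negP-cong {p} {q} p≈q = coeffwise λ i →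
  trans (coeff-negP p i) (trans (cong -_ (coeff-≡ p≈q i)) (sym (coeff-negP q i)))

*P-cong : ∀ {p p′ q q′} → p ≈ p′ → q ≈ q′ → (p *P q) ≈ (p′ *P q′)
*P-cong {p} {p′} {q} {q′} p≈p′ q≈q′ = coeffwise λ n → begin
  coeff (p *P q) n              ≡⟨ coeff-*P p q n ⟩
  sum (convolution p q n)       ≡⟨ sum-cong-≗ (termwise n) ⟩
  sum (convolution p′ q′ n)     ≡⟨ coeff-*P p′ q′ n ⟨
  coeff (p′ *P q′) n            ∎
  where
  open ≡-Reasoning
  termwise : ∀ n i → convolution p q n i ≡ convolution p′ q′ n i
  termwise n i = cong₂ _*_ (coeff-≡ p≈p′ (toℕ i)) (coeff-≡ q≈q′ (n ∸ toℕ i))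

+P-identityʳ : ∀ p {q} → q ≈ [] → (p +P q) ≈ p
+P-identityʳ p {q} q≈0 = coeffwise λ i →
  trans (coeff-+P p q i) (trans (cong (_+_ (coeff p i)) (coeff-≡ q≈0 i)) (ℤP.+-identityʳ _))

+P-identityˡ : ∀ {p} q → p ≈ [] → (p +P q) ≈ q
+P-identityˡ {p} q p≈0 = coeffwise λ i →
  trans (coeff-+P p q i) (trans (cong (_+ coeff q i) (coeff-≡ p≈0 i)) (ℤP.+-identityˡ _))

+P-assoc : ∀ p q r → ((p +P q) +P r) ≈ (p +P (q +P r))
+P-assoc p q r = coeffwise λ i → begin
  coeff ((p +P q) +P r) i
    ≡⟨ trans (coeff-+P (p +P q) r i) (cong (_+ coeff r i) (coeff-+P p q i)) ⟩
  coeff p i + coeff q i + coeff r i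
    ≡⟨ ℤP.+-assoc (coeff p i) _ _ ⟩
  coeff p i + (coeff q i + coeff r i)
    ≡⟨ trans (coeff-+P p (q +P r) i) (cong (_+_ (coeff p i)) (coeff-+P q r i)) ⟨
  coeff (p +P (q +P r)) i ∎
  where open ≡-Reasoning

*P-distribʳ : ∀ p q r → ((p +P q) *P r) ≈ ((p *P r) +P (q *P r))
*P-distribʳ p q r = coeffwise λ n → begin
  coeff ((p +P q) *P r) n
    ≡⟨ coeff-*P (p +P q) r n ⟩
  sum (convolution (p +P q) r n)
    ≡⟨ sum-cong-≗ (split n) ⟩
  sum (λ i → convolution p r n i + convolution q r n i)
    ≡⟨ ∑-distrib-+ (convolution p r n) (convolution q r n) ⟩
  sum (convolution p r n) + sum (convolution q r n)
    ≡⟨ cong₂ _+_ (coeff-*P p r n) (coeff-*P q r n) ⟨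
  coeff (p *P r) n + coeff (q *P r) n
    ≡⟨ coeff-+P (p *P r) (q *P r) n ⟨
  coeff ((p *P r) +P (q *P r)) n ∎
  where
  open ≡-Reasoning
  split : ∀ n i → convolution (p +P q) r n i ≡ convolution p r n i + convolution q r n i
  split n i = trans (cong (_* coeff r (n ∸ toℕ i)) (coeff-+P p q (toℕ i)))
                    (ℤP.*-distribʳ-+ (coeff r (n ∸ toℕ i)) (coeff p (toℕ i)) (coeff q (toℕ i)))

*P-distribˡ : ∀ p q r → (p *P (q +P r)) ≈ ((p *P q) +P (p *P r))
*P-distribˡ p q r = coeffwise λ n → begin
  coeff (p *P (q +P r)) n
    ≡⟨ coeff-*P p (q +P r) n ⟩
  sum (convolution p (q +P r) n)
    ≡⟨ sum-cong-≗ (split n) ⟩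
  sum (λ i → convolution p q n i + convolution p r n i)
    ≡⟨ ∑-distrib-+ (convolution p q n) (convolution p r n) ⟩
  sum (convolution p q n) + sum (convolution p r n)
    ≡⟨ cong₂ _+_ (coeff-*P p q n) (coeff-*P p r n) ⟨
  coeff (p *P q) n + coeff (p *P r) n
    ≡⟨ coeff-+P (p *P q) (p *P r) n ⟨
  coeff ((p *P q) +P (p *P r)) n ∎
  where
  open ≡-Reasoning
  split : ∀ n i → convolution p (q +P r) n i ≡ convolution p q n i + convolution p r n i
  split n i = trans (cong (coeff p (toℕ i) *_) (coeff-+P q r (n ∸ toℕ i)))
                    (ℤP.*-distribˡ-+ (coeff p (toℕ i)) (coeff q (n ∸ toℕ i)) (coeff r (n ∸ toℕ i)))

·P-*P : ∀ a p q → ((a ·P p) *P q) ≈ (a ·P (p *P q))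
·P-*P a p q = coeffwise λ n → begin
  coeff ((a ·P p) *P q) n               ≡⟨ coeff-*P (a ·P p) q n ⟩
  sum (convolution (a ·P p) q n)        ≡⟨ sum-cong-≗ (termwise n) ⟩
  sum (λ i → a * convolution p q n i)   ≡⟨ *-distribˡ-sum a (convolution p q n) ⟨
  a * sum (convolution p q n)           ≡⟨ cong (a *_) (coeff-*P p q n) ⟨
  a * coeff (p *P q) n                  ≡⟨ coeff-·P a (p *P q) n ⟨
  coeff (a ·P (p *P q)) n               ∎
  where
  open ≡-Reasoning
  termwise : ∀ n i → convolution (a ·P p) q n i ≡ a * convolution p q n i
  termwise n i = trans (cong (_* coeff q (n ∸ toℕ i)) (coeff-·P a p (toℕ i)))
                       (ℤP.*-assoc a (coeff p (toℕ i)) (coeff q (n ∸ toℕ i)))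

negP≈-1·P : ∀ p → negP p ≈ ((- 1ℤ) ·P p)
negP≈-1·P p = coeffwise λ i →
  trans (coeff-negP p i) (trans (sym (ℤP.-1*i≡-i (coeff p i))) (sym (coeff-·P (- 1ℤ) p i)))

negP-*P : ∀ p q → (negP p *P q) ≈ negP (p *P q)
negP-*P p q = begin
  negP p *P q             ≈⟨ *P-cong (negP≈-1·P p) ≈-refl ⟩
  ((- 1ℤ) ·P p) *P q      ≈⟨ ·P-*P (- 1ℤ) p q ⟩
  (- 1ℤ) ·P (p *P q)      ≈⟨ negP≈-1·P (p *P q) ⟨
  negP (p *P q)           ∎
  where open ≈-Reasoning

negP-involutive : ∀ p → negP (negP p) ≈ p
negP-involutive p = coeffwise λ i →
  trans (coeff-negP (negP p) i) (trans (cong -_ (coeff-negP p i)) (ℤP.neg-involutive (coeff p i)))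

0∷-*P : ∀ p q → ((0ℤ ∷ p) *P q) ≈ (0ℤ ∷ (p *P q))
0∷-*P p q = coeffwise λ where
  zero    → trans (coeff-+P (0ℤ ·P q) _ 0) (cong (_+ 0ℤ) (coeff-·P 0ℤ q 0))
  (suc n) → trans (coeff-+P (0ℤ ·P q) (0ℤ ∷ (p *P q)) (suc n))
                  (trans (cong (_+ coeff (p *P q) n) (coeff-·P 0ℤ q (suc n))) (ℤP.+-identityˡ (coeff (p *P q) n)))

∷-cong : ∀ a {p q} → p ≈ q → (a ∷ p) ≈ (a ∷ q)
∷-cong a p≈q = coeffwise λ where
  zero    → refl
  (suc i) → coeff-≡ p≈q i

0∷[]≈[] : (0ℤ ∷ []) ≈ []
0∷[]≈[] = coeffwise λ where
  zero    → refl
  (suc i) → refl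

singleton-*P : ∀ c p → ((c ∷ []) *P p) ≈ (c ·P p)
singleton-*P c p = +P-identityʳ (c ·P p) 0∷[]≈[]

*P-identityˡ : ∀ p → (1P *P p) ≈ p
*P-identityˡ p = ≈-trans (singleton-*P 1ℤ p) (coeffwise λ i → trans (coeff-·P 1ℤ p i) (ℤP.*-identityˡ (coeff p i)))

*P-identityʳ : ∀ p → (p *P 1P) ≈ p
*P-identityʳ []      = ≈-refl
*P-identityʳ (a ∷ p) = coeffwise λ where
  zero    → trans (coeff-*P (a ∷ p) 1P 0) (trans (ℤP.+-identityʳ _) (ℤP.*-identityʳ a))
  (suc n) → trans (coeff-+P (a ·P 1P) (0ℤ ∷ (p *P 1P)) (suc n))
                  (trans (cong₂ _+_ (coeff-·P a 1P (suc n)) (coeff-≡ (*P-identityʳ p) n))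
                         (trans (cong (_+ coeff p n) (ℤP.*-zeroʳ a)) (ℤP.+-identityˡ _)))

*P-zeroˡ : ∀ {p} q → p ≈ [] → (p *P q) ≈ []
*P-zeroˡ q p≈0 = *P-cong p≈0 (≈-refl {q})

*P-zeroʳ : ∀ p {q} → q ≈ [] → (p *P q) ≈ []
*P-zeroʳ p {q} q≈0 = coeffwise λ n → trans (coeff-*P p q n) (sum-zero (convolution p q n) (termwise n))
  where
  termwise : ∀ n i → convolution p q n i ≡ 0ℤ
  termwise n i = trans (cong (coeff p (toℕ i) *_) (coeff-≡ q≈0 (n ∸ toℕ i))) (ℤP.*-zeroʳ (coeff p (toℕ i)))

*P-assoc : ∀ p q r → ((p *P q) *P r) ≈ (p *P (q *P r))
*P-assoc []      q r = ≈-refl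
*P-assoc (a ∷ p) q r = begin
  ((a ·P q) +P (0ℤ ∷ (p *P q))) *P r               ≈⟨ *P-distribʳ (a ·P q) _ r ⟩
  ((a ·P q) *P r) +P ((0ℤ ∷ (p *P q)) *P r)        ≈⟨ +P-cong (·P-*P a q r) (0∷-*P (p *P q) r) ⟩
  (a ·P (q *P r)) +P (0ℤ ∷ ((p *P q) *P r))        ≈⟨ +P-cong ≈-refl (∷-cong 0ℤ (*P-assoc p q r)) ⟩
  (a ·P (q *P r)) +P (0ℤ ∷ (p *P (q *P r)))        ∎
  where open ≈-Reasoning

PolyMatrix : ℕ → Set
PolyMatrix n = Fin n → Fin n → Poly

sign : ℕ → Poly → Poly
sign zero          p = p
sign (suc zero)    p = negP p
sign (suc (suc t)) p = sign t p

minor : ∀ {n} → PolyMatrix (suc n) → Fin (suc n) → PolyMatrix n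
minor M j i k = M (fsuc i) (punchIn j k)

expansion : ∀ {n} → PolyMatrix (suc n) → Poly
expansion M = sumP (λ j → sign (toℕ j) (M fzero j *P det (minor M j)))

sumP-≡ : ∀ {n} {f g : Fin n → Poly} → (∀ j → f j ≡ g j) → sumP f ≡ sumP g
sumP-≡ {zero}  f≡g = refl
sumP-≡ {suc n} f≡g = cong₂ _+P_ (f≡g fzero) (sumP-≡ (f≡g ∘ fsuc))

-- The sign function of det is local to its where block and cannot be named, so
-- the left-hand sides below are found by unification; abstracting the column
-- index with `with` is what makes that unification problem solvable.
mutual
  det-expansion : ∀ {n} (M : PolyMatrix (suc n)) → det M ≡ expansion M
  det-expansion M = cong ((M fzero fzero *P det (minor M fzero)) +P_) (sumP-≡ (det-summand M))

  det-summand : ∀ {n} (M : PolyMatrix (suc n)) (j : Fin n) →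
                _ ≡ sign (toℕ (fsuc j)) (M fzero (fsuc j) *P det (minor M (fsuc j)))
  det-summand M j with toℕ (fsuc j) | M fzero (fsuc j) *P det (minor M (fsuc j))
  ... | t | p = det-sign M t p

  det-sign : ∀ {n} (M : PolyMatrix (suc n)) t p → _ ≡ sign t p
  det-sign M zero          p = refl
  det-sign M (suc zero)    p = refl
  det-sign M (suc (suc t)) p = det-sign M t p

sign-cong : ∀ t {p q} → p ≈ q → sign t p ≈ sign t q
sign-cong zero          p≈q = p≈q
sign-cong (suc zero)    p≈q = negP-cong p≈q
sign-cong (suc (suc t)) p≈q = sign-cong t p≈q

sign-zero : ∀ t {p} → p ≈ [] → sign t p ≈ []
sign-zero zero          p≈0 = p≈0
sign-zero (suc zero)    p≈0 = negP-cong p≈0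
sign-zero (suc (suc t)) p≈0 = sign-zero t p≈0

sign-*P : ∀ t p q → sign t (p *P q) ≈ (sign t p *P q)
sign-*P zero          p q = ≈-refl
sign-*P (suc zero)    p q = ≈-sym (negP-*P p q)
sign-*P (suc (suc t)) p q = sign-*P t p q

sumP-cong : ∀ {n} {f g : Fin n → Poly} → (∀ j → f j ≈ g j) → sumP f ≈ sumP g
sumP-cong {zero}  f≈g = ≈-refl
sumP-cong {suc n} f≈g = +P-cong (f≈g fzero) (sumP-cong (f≈g ∘ fsuc))

sumP-zero : ∀ {n} {f : Fin n → Poly} → (∀ j → f j ≈ []) → sumP f ≈ []
sumP-zero {zero}  f≈0 = ≈-refl
sumP-zero {suc n} f≈0 = ≈-trans (+P-identityˡ _ (f≈0 fzero)) (sumP-zero (f≈0 ∘ fsuc))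

sumP-*P : ∀ {n} (f : Fin n → Poly) q → sumP (λ j → f j *P q) ≈ (sumP f *P q)
sumP-*P {zero}  f q = ≈-refl
sumP-*P {suc n} f q = ≈-trans (+P-cong ≈-refl (sumP-*P (f ∘ fsuc) q)) (≈-sym (*P-distribʳ (f fzero) _ q))

sumP-↑ : ∀ a {b} (f : Fin (a ℕ.+ b) → Poly) → sumP f ≈ (sumP (f ∘ (_↑ˡ b)) +P sumP (f ∘ (a ↑ʳ_)))
sumP-↑ zero    f = ≈-refl
sumP-↑ (suc a) f = ≈-trans (+P-cong ≈-refl (sumP-↑ a (f ∘ fsuc))) (≈-sym (+P-assoc (f fzero) _ _))

det-cong : ∀ {n} {M M′ : PolyMatrix n} → (∀ i j → M i j ≈ M′ i j) → det M ≈ det M′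
det-cong {zero}           M≈M′ = ≈-refl
det-cong {suc n} {M} {M′} M≈M′ = begin
  det M         ≡⟨ det-expansion M ⟩
  expansion M   ≈⟨ sumP-cong summand≈ ⟩
  expansion M′  ≡⟨ det-expansion M′ ⟨
  det M′        ∎
  where
  open ≈-Reasoning
  summand≈ : ∀ j → sign (toℕ j) (M fzero j *P det (minor M j)) ≈ sign (toℕ j) (M′ fzero j *P det (minor M′ j))
  summand≈ j = sign-cong (toℕ j) (*P-cong (M≈M′ fzero j) (det-cong (λ i k → M≈M′ (fsuc i) (punchIn j k))))

det-zero-column : ∀ {n} (M : PolyMatrix n) c → (∀ i → M i c ≈ []) → det M ≈ []
det-zero-column {suc n} M c Mc≈0 = ≈-trans (≡⇒≈ (det-expansion M)) (sumP-zero summand≈0)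
  where
  summand≈0 : ∀ j → sign (toℕ j) (M fzero j *P det (minor M j)) ≈ []
  summand≈0 j with j FinP.≟ c
  ... | yes refl = sign-zero (toℕ j) (*P-zeroˡ _ (Mc≈0 fzero))
  ... | no j≢c   = sign-zero (toℕ j) (*P-zeroʳ (M fzero j) (det-zero-column (minor M j) (Fin.punchOut j≢c) column≈0))
    where
    column≈0 : ∀ i → minor M j i (Fin.punchOut j≢c) ≈ []
    column≈0 i = ≈-trans (≡⇒≈ (cong (M (fsuc i)) (FinP.punchIn-punchOut j≢c))) (Mc≈0 (fsuc i))

record BlockTriangular {a b} (M : PolyMatrix (a ℕ.+ b)) (X : PolyMatrix a) (Y : PolyMatrix b) : Set where
  field
    upper-left  : ∀ i j → M (i ↑ˡ b) (j ↑ˡ b) ≈ X i j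
    lower-right : ∀ i j → M (a ↑ʳ i) (a ↑ʳ j) ≈ Y i j
    upper-right : ∀ i j → M (i ↑ˡ b) (a ↑ʳ j) ≈ []

punchIn-↑ˡ : ∀ {a} b (j : Fin (suc a)) (k : Fin a) → punchIn (j ↑ˡ b) (k ↑ˡ b) ≡ punchIn j k ↑ˡ b
punchIn-↑ˡ b fzero    k        = refl
punchIn-↑ˡ b (fsuc j) fzero    = refl
punchIn-↑ˡ b (fsuc j) (fsuc k) = cong fsuc (punchIn-↑ˡ b j k)

punchIn-↑ʳ : ∀ a {b} (j : Fin (suc a)) (k : Fin b) → punchIn (j ↑ˡ b) (a ↑ʳ k) ≡ suc a ↑ʳ k
punchIn-↑ʳ a       fzero    k = refl
punchIn-↑ʳ (suc a) (fsuc j) k = cong fsuc (punchIn-↑ʳ a j k)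

minor-blockTriangular : ∀ {a b} {M : PolyMatrix (suc a ℕ.+ b)} {X : PolyMatrix (suc a)} {Y : PolyMatrix b} →
                        BlockTriangular M X Y → ∀ j → BlockTriangular (minor M (j ↑ˡ b)) (minor X j) Y
minor-blockTriangular {a} {b} {M} T j = record
  { upper-left  = λ i k → ≈-trans (entry≡ (fsuc (i ↑ˡ b)) (punchIn-↑ˡ b j k)) (upper-left (fsuc i) (punchIn j k))
  ; lower-right = λ i k → ≈-trans (entry≡ (fsuc (a ↑ʳ i)) (punchIn-↑ʳ a j k)) (lower-right i k)
  ; upper-right = λ i k → ≈-trans (entry≡ (fsuc (i ↑ˡ b)) (punchIn-↑ʳ a j k)) (upper-right (fsuc i) k)
  }
  where
  open BlockTriangular T
  entry≡ : ∀ i {k k′} → k ≡ k′ → M i k ≈ M i k′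
  entry≡ i k≡k′ = ≡⇒≈ (cong (M i) k≡k′)

det-blockTriangular : ∀ {a b} {M : PolyMatrix (a ℕ.+ b)} {X : PolyMatrix a} {Y : PolyMatrix b} →
                      BlockTriangular M X Y → det M ≈ (det X *P det Y)
det-blockTriangular {zero} {Y = Y} T =
  ≈-trans (det-cong (BlockTriangular.lower-right T)) (≈-sym (*P-identityˡ (det Y)))
det-blockTriangular {suc a} {b} {M} {X} {Y} T = begin
  det M                                                      ≡⟨ det-expansion M ⟩
  expansion M                                                ≈⟨ sumP-↑ (suc a) summand ⟩
  sumP (summand ∘ (_↑ˡ b)) +P sumP (summand ∘ (suc a ↑ʳ_))   ≈⟨ +P-identityʳ (sumP (summand ∘ (_↑ˡ b))) (sumP-zero right≈0) ⟩
  sumP (summand ∘ (_↑ˡ b))                                   ≈⟨ sumP-cong left≈ ⟩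
  sumP (λ j → summandX j *P det Y)                           ≈⟨ sumP-*P summandX (det Y) ⟩
  expansion X *P det Y                                       ≡⟨ cong (_*P det Y) (det-expansion X) ⟨
  det X *P det Y                                             ∎
  where
  open ≈-Reasoning
  open BlockTriangular T
  summand : Fin (suc a ℕ.+ b) → Poly
  summand j = sign (toℕ j) (M fzero j *P det (minor M j))
  summandX : Fin (suc a) → Poly
  summandX j = sign (toℕ j) (X fzero j *P det (minor X j))
  right≈0 : ∀ j → summand (suc a ↑ʳ j) ≈ []
  right≈0 j = sign-zero (toℕ (suc a ↑ʳ j)) (*P-zeroˡ _ (upper-right fzero j))
  left≈ : ∀ j → summand (j ↑ˡ b) ≈ (summandX j *P det Y)
  left≈ j = begin
    summand (j ↑ˡ b)
      ≡⟨ cong (λ t → sign t (M fzero (j ↑ˡ b) *P det (minor M (j ↑ˡ b)))) (FinP.toℕ-↑ˡ j b) ⟩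
    sign (toℕ j) (M fzero (j ↑ˡ b) *P det (minor M (j ↑ˡ b)))
      ≈⟨ sign-cong (toℕ j) (*P-cong (upper-left fzero j) (det-blockTriangular (minor-blockTriangular T j))) ⟩
    sign (toℕ j) (X fzero j *P (det (minor X j) *P det Y))
      ≈⟨ sign-cong (toℕ j) (≈-sym (*P-assoc (X fzero j) _ _)) ⟩
    sign (toℕ j) ((X fzero j *P det (minor X j)) *P det Y)
      ≈⟨ sign-*P (toℕ j) _ (det Y) ⟩
    summandX j *P det Y ∎

↑ˡ≢↑ʳ : ∀ {a b} (i : Fin a) (j : Fin b) → i ↑ˡ b ≢ a ↑ʳ j
↑ˡ≢↑ʳ {a} {b} i j eq = ℕP.<⇒≢ (ℕP.<-≤-trans (FinP.toℕ<n i) (ℕP.m≤m+n a (toℕ j)))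
  (trans (sym (FinP.toℕ-↑ˡ i b)) (trans (cong toℕ eq) (FinP.toℕ-↑ʳ a j)))

does-↑ˡ : ∀ {a} b (i j : Fin a) → does (i ↑ˡ b Fin.≟ j ↑ˡ b) ≡ does (i Fin.≟ j)
does-↑ˡ b i j = does-⇔ (mk⇔ (FinP.↑ˡ-injective b i j) (cong (_↑ˡ b))) (i ↑ˡ b Fin.≟ j ↑ˡ b) (i Fin.≟ j)

does-↑ʳ : ∀ a {b} (i j : Fin b) → does (a ↑ʳ i Fin.≟ a ↑ʳ j) ≡ does (i Fin.≟ j)
does-↑ʳ a i j = does-⇔ (mk⇔ (FinP.↑ʳ-injective a i j) (cong (a ↑ʳ_))) (a ↑ʳ i Fin.≟ a ↑ʳ j) (i Fin.≟ j)

does-↑ˡ↑ʳ : ∀ {a b} (i : Fin a) (j : Fin b) → does (i ↑ˡ b Fin.≟ a ↑ʳ j) ≡ false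
does-↑ˡ↑ʳ {a} {b} i j = dec-false (i ↑ˡ b Fin.≟ a ↑ʳ j) (↑ˡ≢↑ʳ i j)

does-↑ʳ↑ˡ : ∀ {a b} (i : Fin b) (j : Fin a) → does (a ↑ʳ i Fin.≟ j ↑ˡ b) ≡ false
does-↑ʳ↑ˡ {a} {b} i j = dec-false (a ↑ʳ i Fin.≟ j ↑ˡ b) (↑ˡ≢↑ʳ j i ∘ sym)

record BlockDiagonal {a b} (M : Mat (a ℕ.+ b)) (X : Mat a) (Y : Mat b) : Set where
  field
    upper-left  : ∀ i j → M (i ↑ˡ b) (j ↑ˡ b) ≡ X i j
    lower-right : ∀ i j → M (a ↑ʳ i) (a ↑ʳ j) ≡ Y i j
    upper-right : ∀ i j → M (i ↑ˡ b) (a ↑ʳ j) ≡ 0ℤ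
    lower-left  : ∀ i j → M (a ↑ʳ i) (j ↑ˡ b) ≡ 0ℤ

A-⊕ : ∀ Γ Δ → BlockDiagonal (A (Γ ⊕ Δ)) (A Γ) (A Δ)
A-⊕ Γ Δ = record
  { upper-left  = λ i j → cong b2z (adj-ll i j)
  ; lower-right = λ i j → cong b2z (adj-rr i j)
  ; upper-right = λ i j → cong b2z (adj-lr i j)
  ; lower-left  = λ i j → cong b2z (adj-rl i j)
  }
  where
  adj-ll : ∀ i j → adj (Γ ⊕ Δ) (i ↑ˡ size Δ) (j ↑ˡ size Δ) ≡ adj Γ i j
  adj-ll i j rewrite FinP.splitAt-↑ˡ (size Γ) i (size Δ) | FinP.splitAt-↑ˡ (size Γ) j (size Δ) = refl
  adj-rr : ∀ i j → adj (Γ ⊕ Δ) (size Γ ↑ʳ i) (size Γ ↑ʳ j) ≡ adj Δ i j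
  adj-rr i j rewrite FinP.splitAt-↑ʳ (size Γ) (size Δ) i | FinP.splitAt-↑ʳ (size Γ) (size Δ) j = refl
  adj-lr : ∀ i j → adj (Γ ⊕ Δ) (i ↑ˡ size Δ) (size Γ ↑ʳ j) ≡ false
  adj-lr i j rewrite FinP.splitAt-↑ˡ (size Γ) i (size Δ) | FinP.splitAt-↑ʳ (size Γ) (size Δ) j = refl
  adj-rl : ∀ i j → adj (Γ ⊕ Δ) (size Γ ↑ʳ i) (j ↑ˡ size Δ) ≡ false
  adj-rl i j rewrite FinP.splitAt-↑ʳ (size Γ) (size Δ) i | FinP.splitAt-↑ˡ (size Γ) j (size Δ) = refl

idMat-blockDiagonal : ∀ a b → BlockDiagonal {a} {b} idMat idMat idMat
idMat-blockDiagonal a b = record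
  { upper-left  = λ i j → cong indicator (does-↑ˡ b i j)
  ; lower-right = λ i j → cong indicator (does-↑ʳ a i j)
  ; upper-right = λ i j → cong indicator (does-↑ˡ↑ʳ i j)
  ; lower-left  = λ i j → cong indicator (does-↑ʳ↑ˡ i j)
  }
  where
  indicator : Bool → ℤ
  indicator d = if d then 1ℤ else 0ℤ

⊗-split : ∀ {a b} (M N : Mat (a ℕ.+ b)) i j →
          (M ⊗ N) i j ≡ sum (λ k → M i (k ↑ˡ b) * N (k ↑ˡ b) j) + sum (λ k → M i (a ↑ʳ k) * N (a ↑ʳ k) j)
⊗-split {a} M N i j = trans (sumFin≡sum (λ k → M i k * N k j)) (sum-↑ a (λ k → M i k * N k j))

⊗-blockDiagonal : ∀ {a b} {M N : Mat (a ℕ.+ b)} {X X′ : Mat a} {Y Y′ : Mat b} →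
                  BlockDiagonal M X Y → BlockDiagonal N X′ Y′ → BlockDiagonal (M ⊗ N) (X ⊗ X′) (Y ⊗ Y′)
⊗-blockDiagonal {a} {b} {M} {N} {X} {X′} {Y} {Y′} BM BN = record
  { upper-left  = λ i j → trans (⊗-split {a} {b} M N (i ↑ˡ b) (j ↑ˡ b)) (trans
      (cong₂ _+_ (block X X′ i j (M.upper-left i) (flip N.upper-left j))
                 (vanishˡ (λ k → N (a ↑ʳ k) (j ↑ˡ b)) (M.upper-right i)))
      (ℤP.+-identityʳ _))
  ; lower-right = λ i j → trans (⊗-split {a} {b} M N (a ↑ʳ i) (a ↑ʳ j)) (trans
      (cong₂ _+_ (vanishˡ (λ k → N (k ↑ˡ b) (a ↑ʳ j)) (M.lower-left i))
                 (block Y Y′ i j (M.lower-right i) (flip N.lower-right j)))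
      (ℤP.+-identityˡ _))
  ; upper-right = λ i j → trans (⊗-split {a} {b} M N (i ↑ˡ b) (a ↑ʳ j))
      (cong₂ _+_ (vanishʳ (λ k → M (i ↑ˡ b) (k ↑ˡ b)) (flip N.upper-right j))
                 (vanishˡ (λ k → N (a ↑ʳ k) (a ↑ʳ j)) (M.upper-right i)))
  ; lower-left  = λ i j → trans (⊗-split {a} {b} M N (a ↑ʳ i) (j ↑ˡ b))
      (cong₂ _+_ (vanishˡ (λ k → N (k ↑ˡ b) (j ↑ˡ b)) (M.lower-left i))
                 (vanishʳ (λ k → M (a ↑ʳ i) (a ↑ʳ k)) (flip N.lower-left j)))
  }
  where
  module M = BlockDiagonal BM
  module N = BlockDiagonal BN
  block : ∀ {n} {f g : Fin n → ℤ} (U V : Mat n) i j →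
          (∀ k → f k ≡ U i k) → (∀ k → g k ≡ V k j) → sum (λ k → f k * g k) ≡ (U ⊗ V) i j
  block U V i j f≡ g≡ =
    trans (sum-cong-≗ λ k → cong₂ _*_ (f≡ k) (g≡ k)) (sym (sumFin≡sum (λ k → U i k * V k j)))
  vanishˡ : ∀ {n} {f : Fin n → ℤ} (g : Fin n → ℤ) → (∀ k → f k ≡ 0ℤ) → sum (λ k → f k * g k) ≡ 0ℤ
  vanishˡ {f = f} g f≡0 = sum-zero (λ k → f k * g k) λ k → trans (cong (_* g k) (f≡0 k)) (ℤP.*-zeroˡ (g k))
  vanishʳ : ∀ {n} (f : Fin n → ℤ) {g : Fin n → ℤ} → (∀ k → g k ≡ 0ℤ) → sum (λ k → f k * g k) ≡ 0ℤ
  vanishʳ f {g} g≡0 = sum-zero (λ k → f k * g k) λ k → trans (cong (f k *_) (g≡0 k)) (ℤP.*-zeroʳ (f k))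

^M-blockDiagonal : ∀ {a b} {M : Mat (a ℕ.+ b)} {X : Mat a} {Y : Mat b} →
                   BlockDiagonal M X Y → ∀ k → BlockDiagonal (M ^M k) (X ^M k) (Y ^M k)
^M-blockDiagonal {a} {b} B zero    = idMat-blockDiagonal a b
^M-blockDiagonal         B (suc k) = ⊗-blockDiagonal B (^M-blockDiagonal B k)

oneMone-blockDiagonal : ∀ {a b} {M : Mat (a ℕ.+ b)} {X : Mat a} {Y : Mat b} →
                        BlockDiagonal M X Y → oneMone M ≡ oneMone X + oneMone Y
oneMone-blockDiagonal {a} {b} {M} {X} {Y} B = begin
  oneMone M
    ≡⟨ sumFin≡sum (λ i → sumFin (M i)) ⟩
  sum (λ i → sumFin (M i))
    ≡⟨ sum-↑ a (λ i → sumFin (M i)) ⟩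
  sum (λ i → sumFin (M (i ↑ˡ b))) + sum (λ i → sumFin (M (a ↑ʳ i)))
    ≡⟨ cong₂ _+_ (sum-cong-≗ upper-rows) (sum-cong-≗ lower-rows) ⟩
  sum (λ i → sumFin (X i)) + sum (λ i → sumFin (Y i))
    ≡⟨ cong₂ _+_ (sumFin≡sum (λ i → sumFin (X i))) (sumFin≡sum (λ i → sumFin (Y i))) ⟨
  oneMone X + oneMone Y ∎
  where
  open ≡-Reasoning
  open BlockDiagonal B
  row-split : ∀ i → sumFin (M i) ≡ sum (λ j → M i (j ↑ˡ b)) + sum (λ j → M i (a ↑ʳ j))
  row-split i = trans (sumFin≡sum (M i)) (sum-↑ a (M i))
  upper-rows : ∀ i → sumFin (M (i ↑ˡ b)) ≡ sumFin (X i)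
  upper-rows i = trans (row-split (i ↑ˡ b)) (trans
    (cong₂ _+_ (sum-cong-≗ (upper-left i)) (sum-zero (λ j → M (i ↑ˡ b) (a ↑ʳ j)) (upper-right i)))
    (trans (ℤP.+-identityʳ _) (sym (sumFin≡sum (X i)))))
  lower-rows : ∀ i → sumFin (M (a ↑ʳ i)) ≡ sumFin (Y i)
  lower-rows i = trans (row-split (a ↑ʳ i)) (trans
    (cong₂ _+_ (sum-zero (λ j → M (a ↑ʳ i) (j ↑ˡ b)) (lower-left i)) (sum-cong-≗ (lower-right i)))
    (trans (ℤP.+-identityˡ _) (sym (sumFin≡sum (Y i)))))

oneMone-⊕ : ∀ Γ Δ k → oneMone (A (Γ ⊕ Δ) ^M k) ≡ oneMone (A Γ ^M k) + oneMone (A Δ ^M k)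
oneMone-⊕ Γ Δ k = oneMone-blockDiagonal (^M-blockDiagonal (A-⊕ Γ Δ) k)

oneMone-copies : ∀ d Γ k → oneMone (A (copies d Γ) ^M k) ≡ + d * oneMone (A Γ ^M k)
oneMone-copies zero    Γ k = sym (ℤP.*-zeroˡ (oneMone (A Γ ^M k)))
oneMone-copies (suc d) Γ k = begin
  oneMone (A (Γ ⊕ copies d Γ) ^M k)
    ≡⟨ oneMone-⊕ Γ (copies d Γ) k ⟩
  oneMone (A Γ ^M k) + oneMone (A (copies d Γ) ^M k)
    ≡⟨ cong (_+_ (oneMone (A Γ ^M k))) (oneMone-copies d Γ k) ⟩
  oneMone (A Γ ^M k) + + d * oneMone (A Γ ^M k)
    ≡⟨ cong (_+ + d * oneMone (A Γ ^M k)) (ℤP.*-identityˡ (oneMone (A Γ ^M k))) ⟨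
  1ℤ * oneMone (A Γ ^M k) + + d * oneMone (A Γ ^M k)
    ≡⟨ ℤP.*-distribʳ-+ (oneMone (A Γ ^M k)) 1ℤ (+ d) ⟨
  + suc d * oneMone (A Γ ^M k) ∎
  where open ≡-Reasoning

charMatrix : ∀ {n} → Mat n → PolyMatrix n
charMatrix M i j = if does (i Fin.≟ j) then (- M i j) ∷ 1ℤ ∷ [] else (- M i j) ∷ []

charMatrix-blockTriangular : ∀ {a b} {M : Mat (a ℕ.+ b)} {X : Mat a} {Y : Mat b} →
                             BlockDiagonal M X Y → BlockTriangular (charMatrix M) (charMatrix X) (charMatrix Y)
charMatrix-blockTriangular {a} {b} B = record
  { upper-left  = λ i j → ≡⇒≈ (cong₂ entry (does-↑ˡ b i j) (cong -_ (upper-left i j)))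
  ; lower-right = λ i j → ≡⇒≈ (cong₂ entry (does-↑ʳ a i j) (cong -_ (lower-right i j)))
  ; upper-right = λ i j → ≈-trans (≡⇒≈ (cong₂ entry (does-↑ˡ↑ʳ i j) (cong -_ (upper-right i j)))) 0∷[]≈[]
  }
  where
  open BlockDiagonal B
  entry : Bool → ℤ → Poly
  entry d c = if d then c ∷ 1ℤ ∷ [] else c ∷ []

Char-⊕ : ∀ Γ Δ → Char (A (Γ ⊕ Δ)) ≈ (Char (A Γ) *P Char (A Δ))
Char-⊕ Γ Δ = det-blockTriangular (charMatrix-blockTriangular (A-⊕ Γ Δ))

_^P_ : Poly → ℕ → Poly
p ^P zero  = 1P
p ^P suc d = p *P (p ^P d)

^P-cong : ∀ d {p q} → p ≈ q → (p ^P d) ≈ (q ^P d)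
^P-cong zero    p≈q = ≈-refl
^P-cong (suc d) p≈q = *P-cong p≈q (^P-cong d p≈q)

^P-+ : ∀ p a b → (p ^P (a ℕ.+ b)) ≈ ((p ^P a) *P (p ^P b))
^P-+ p zero    b = ≈-sym (*P-identityˡ (p ^P b))
^P-+ p (suc a) b = ≈-trans (*P-cong (≈-refl {p}) (^P-+ p a b)) (≈-sym (*P-assoc p (p ^P a) (p ^P b)))

coeff-*P-0 : ∀ p q → coeff (p *P q) 0 ≡ coeff p 0 * coeff q 0
coeff-*P-0 p q = trans (coeff-*P p q 0) (ℤP.+-identityʳ _)

coeff-^P-0 : ∀ d {p} → coeff p 0 ≡ 1ℤ → coeff (p ^P d) 0 ≡ 1ℤ
coeff-^P-0 zero    _    = refl
coeff-^P-0 (suc d) {p} p₀≡1 = trans (coeff-*P-0 p (p ^P d)) (cong₂ _*_ p₀≡1 (coeff-^P-0 d p₀≡1))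

Char-copies : ∀ d Γ → Char (A (copies d Γ)) ≈ (Char (A Γ) ^P d)
Char-copies zero    Γ = ≈-refl
Char-copies (suc d) Γ = ≈-trans (Char-⊕ Γ (copies d Γ)) (*P-cong (≈-refl {Char (A Γ)}) (Char-copies d Γ))

pathPoly : ℕ → Poly
pathPoly zero          = 1P
pathPoly (suc zero)    = 0ℤ ∷ 1P
pathPoly (suc (suc N)) = (0ℤ ∷ pathPoly (suc N)) +P negP (pathPoly N)

pathMatrix : (N : ℕ) → PolyMatrix N
pathMatrix N = charMatrix (A (P N))

x-*P : ∀ p → ((0ℤ ∷ 1P) *P p) ≈ (0ℤ ∷ p)
x-*P p = ≈-trans (0∷-*P 1P p) (∷-cong 0ℤ (*P-identityˡ p))

-1-*P : ∀ p → (((- 1ℤ) ∷ []) *P p) ≈ negP p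
-1-*P p = ≈-trans (singleton-*P (- 1ℤ) p) (≈-sym (negP≈-1·P p))

det-head : ∀ {n} (M : PolyMatrix (suc n)) → (∀ j → (M fzero (fsuc j) *P det (minor M (fsuc j))) ≈ []) →
           det M ≈ (M fzero fzero *P det (minor M fzero))
det-head M tail≈0 = ≈-trans (≡⇒≈ (det-expansion M))
  (+P-identityʳ _ (sumP-zero λ j → sign-zero (toℕ (fsuc j)) (tail≈0 j)))

-- Removing the second column of the path matrix leaves a matrix whose first
-- row is (-1, -1, 0, …) and whose second minor has a zero first column.
det-pathMatrix-minor₁ : ∀ N → det (minor (pathMatrix (suc (suc N))) (fsuc fzero)) ≈ negP (det (pathMatrix N))
det-pathMatrix-minor₁ N = ≈-trans (det-head Q tail≈0) (-1-*P (det (pathMatrix N)))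
  where
  Q = minor (pathMatrix (suc (suc N))) (fsuc fzero)
  tail≈0 : ∀ j → (Q fzero (fsuc j) *P det (minor Q (fsuc j))) ≈ []
  tail≈0 fzero    = *P-zeroʳ (Q fzero (fsuc fzero)) (det-zero-column (minor Q (fsuc fzero)) fzero λ i → 0∷[]≈[])
  tail≈0 (fsuc j) = *P-zeroˡ (det (minor Q (fsuc (fsuc j)))) 0∷[]≈[]

-- Expanding along the first row (x, -1, 0, …); the first minor is literally the matrix of P (N+1).
Char-path : ∀ N → Char (A (P N)) ≈ pathPoly N
Char-path zero          = ≈-refl
Char-path (suc zero)    = coeffwise λ where
  0 → refl
  1 → refl
  2 → refl
  (suc (suc (suc i))) → refl
Char-path (suc (suc N)) = begin
  det M
    ≡⟨ det-expansion M ⟩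
  (x *P det (pathMatrix (suc N))) +P (negP (minusOne *P det Q) +P sumP rest)
    ≈⟨ +P-cong (x-*P (det (pathMatrix (suc N)))) (+P-identityʳ (negP (minusOne *P det Q)) (sumP-zero rest≈0)) ⟩
  (0ℤ ∷ det (pathMatrix (suc N))) +P negP (minusOne *P det Q)
    ≈⟨ +P-cong (∷-cong 0ℤ (Char-path (suc N))) (negP-cong (-1-*P (det Q))) ⟩
  (0ℤ ∷ pathPoly (suc N)) +P negP (negP (det Q))
    ≈⟨ +P-cong ≈-refl (≈-trans (negP-involutive _) (det-pathMatrix-minor₁ N)) ⟩
  (0ℤ ∷ pathPoly (suc N)) +P negP (det (pathMatrix N))
    ≈⟨ +P-cong ≈-refl (negP-cong (Char-path N)) ⟩
  pathPoly (suc (suc N)) ∎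
  where
  open ≈-Reasoning
  M = pathMatrix (suc (suc N))
  Q = minor M (fsuc fzero)
  x minusOne : Poly
  x = 0ℤ ∷ 1P
  minusOne = (- 1ℤ) ∷ []
  rest : Fin N → Poly
  rest j = sign (toℕ (fsuc (fsuc j))) (M fzero (fsuc (fsuc j)) *P det (minor M (fsuc (fsuc j))))
  rest≈0 : ∀ j → rest j ≈ []
  rest≈0 j = sign-zero (toℕ j) (*P-zeroˡ (det (minor M (fsuc (fsuc j)))) 0∷[]≈[])

two^ : ℕ → ℤ
two^ k = + (2 ^ k)

2^-∣ : ∀ {m n} → m ≤ n → 2 ^ m ∣ 2 ^ n
2^-∣ {m} {n} m≤n = divides (2 ^ (n ∸ m)) (begin
  2 ^ n                 ≡⟨ cong (2 ^_) (ℕP.m∸n+n≡m m≤n) ⟨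
  2 ^ (n ∸ m ℕ.+ m)     ≡⟨ ℕP.^-distribˡ-+-* 2 (n ∸ m) m ⟩
  2 ^ (n ∸ m) ℕ.* 2 ^ m ∎)
  where open ≡-Reasoning

1+[2^m∸1]≡2^m : ∀ m → suc (2 ^ m ∸ 1) ≡ 2 ^ m
1+[2^m∸1]≡2^m m = ℕP.m+[n∸m]≡n (ℕP.m^n>0 2 m)

two^-+ : ∀ m n → two^ (m ℕ.+ n) ≡ two^ m * two^ n
two^-+ m n = trans (cong +_ (ℕP.^-distribˡ-+-* 2 m n)) (ℤP.pos-* (2 ^ m) (2 ^ n))

two^-∣ : ∀ {m n} → m ≤ n → two^ m ∣ℤ two^ n
two^-∣ m≤n = ℤ∣.∣ᵤ⇒∣ (2^-∣ m≤n)

shift : ℕ → Poly → Poly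
shift zero    p = p
shift (suc K) p = 0ℤ ∷ shift K p

coeff-shift-< : ∀ K p {k} → k < K → coeff (shift K p) k ≡ 0ℤ
coeff-shift-< (suc K) p {zero}  _       = refl
coeff-shift-< (suc K) p {suc k} (s≤s k<K) = coeff-shift-< K p k<K

coeff-shift-+ : ∀ K p k → coeff (shift K p) (K ℕ.+ k) ≡ coeff p k
coeff-shift-+ zero    p k = refl
coeff-shift-+ (suc K) p k = coeff-shift-+ K p k

shift-cong : ∀ K {p q} → p ≈ q → shift K p ≈ shift K q
shift-cong zero    p≈q = p≈q
shift-cong (suc K) p≈q = ∷-cong 0ℤ (shift-cong K p≈q)

shift-*P : ∀ K p q → (shift K p *P q) ≈ shift K (p *P q)
shift-*P zero    p q = ≈-refl
shift-*P (suc K) p q = ≈-trans (0∷-*P (shift K p) q) (∷-cong 0ℤ (shift-*P K p q))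

·P-·P : ∀ a b p → (a ·P (b ·P p)) ≈ ((a * b) ·P p)
·P-·P a b p = coeffwise λ i → begin
  coeff (a ·P (b ·P p)) i  ≡⟨ trans (coeff-·P a (b ·P p) i) (cong (a *_) (coeff-·P b p i)) ⟩
  a * (b * coeff p i)      ≡⟨ ℤP.*-assoc a b (coeff p i) ⟨
  a * b * coeff p i        ≡⟨ coeff-·P (a * b) p i ⟨
  coeff ((a * b) ·P p) i   ∎
  where open ≡-Reasoning

-- r(y) = (2y)^D p(1/(2y)) for a polynomial p of degree at most D.
record ScaledReversal (D : ℕ) (p r : Poly) : Set where
  field
    coeff-reversed : ∀ k → k ≤ D → coeff r k ≡ two^ k * coeff p (D ∸ k)
    coeff-beyond   : ∀ k → D < k → coeff r k ≡ 0ℤ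
    degree-≤       : ∀ i → D < i → coeff p i ≡ 0ℤ
open ScaledReversal

coeff-by-cases : ∀ D {r r′ : Poly} → (∀ k → k ≤ D → coeff r k ≡ coeff r′ k) →
                 (∀ k → D < k → coeff r k ≡ coeff r′ k) → r ≈ r′
coeff-by-cases D ≤D >D = coeffwise λ k → [ ≤D k , >D k ]′ (ℕP.≤-<-connex k D)

reversal-unique : ∀ {D p r r′} → ScaledReversal D p r → ScaledReversal D p r′ → r ≈ r′
reversal-unique {D} R R′ = coeff-by-cases D
  (λ k k≤D → trans (coeff-reversed R k k≤D) (sym (coeff-reversed R′ k k≤D)))
  (λ k D<k → trans (coeff-beyond R k D<k) (sym (coeff-beyond R′ k D<k)))

reversal-cong : ∀ {D p p′ r r′} → ScaledReversal D p r → p ≈ p′ → r ≈ r′ → ScaledReversal D p′ r′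
reversal-cong {D} R p≈p′ r≈r′ = record
  { coeff-reversed = λ k k≤D → trans (sym (coeff-≡ r≈r′ k))
                                     (trans (coeff-reversed R k k≤D) (cong (two^ k *_) (coeff-≡ p≈p′ (D ∸ k))))
  ; coeff-beyond   = λ k D<k → trans (sym (coeff-≡ r≈r′ k)) (coeff-beyond R k D<k)
  ; degree-≤       = λ i D<i → trans (sym (coeff-≡ p≈p′ i)) (degree-≤ R i D<i)
  }

reversal-[] : ∀ {D r} → ScaledReversal D [] r → r ≈ []
reversal-[] {D} R = coeff-by-cases D
  (λ k k≤D → trans (coeff-reversed R k k≤D) (ℤP.*-zeroʳ (two^ k)))
  (coeff-beyond R)

reversal-of-[] : ∀ {D r} → r ≈ [] → ScaledReversal D [] r
reversal-of-[] r≈0 = record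
  { coeff-reversed = λ k _ → trans (coeff-≡ r≈0 k) (sym (ℤP.*-zeroʳ (two^ k)))
  ; coeff-beyond   = λ k _ → coeff-≡ r≈0 k
  ; degree-≤       = λ _ _ → refl
  }

reversal-+P : ∀ {D p q r s} → ScaledReversal D p r → ScaledReversal D q s → ScaledReversal D (p +P q) (r +P s)
reversal-+P {D} {p} {q} {r} {s} R S = record
  { coeff-reversed = λ k k≤D → begin
      coeff (r +P s) k
        ≡⟨ coeff-+P r s k ⟩
      coeff r k + coeff s k
        ≡⟨ cong₂ _+_ (coeff-reversed R k k≤D) (coeff-reversed S k k≤D) ⟩
      two^ k * coeff p (D ∸ k) + two^ k * coeff q (D ∸ k)
        ≡⟨ ℤP.*-distribˡ-+ (two^ k) _ _ ⟨
      two^ k * (coeff p (D ∸ k) + coeff q (D ∸ k))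
        ≡⟨ cong (two^ k *_) (coeff-+P p q (D ∸ k)) ⟨
      two^ k * coeff (p +P q) (D ∸ k) ∎
  ; coeff-beyond   = λ k D<k → trans (coeff-+P r s k) (cong₂ _+_ (coeff-beyond R k D<k) (coeff-beyond S k D<k))
  ; degree-≤       = λ i D<i → trans (coeff-+P p q i) (cong₂ _+_ (degree-≤ R i D<i) (degree-≤ S i D<i))
  }
  where open ≡-Reasoning

reversal-·P : ∀ a {D p r} → ScaledReversal D p r → ScaledReversal D (a ·P p) (a ·P r)
reversal-·P a {D} {p} {r} R = record
  { coeff-reversed = λ k k≤D → begin
      coeff (a ·P r) k                    ≡⟨ coeff-·P a r k ⟩
      a * coeff r k                       ≡⟨ cong (a *_) (coeff-reversed R k k≤D) ⟩
      a * (two^ k * coeff p (D ∸ k))      ≡⟨ x∙yz≈y∙xz a (two^ k) (coeff p (D ∸ k)) ⟩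
      two^ k * (a * coeff p (D ∸ k))      ≡⟨ cong (two^ k *_) (coeff-·P a p (D ∸ k)) ⟨
      two^ k * coeff (a ·P p) (D ∸ k)     ∎
  ; coeff-beyond   = λ k D<k → trans (coeff-·P a r k) (trans (cong (a *_) (coeff-beyond R k D<k)) (ℤP.*-zeroʳ a))
  ; degree-≤       = λ i D<i → trans (coeff-·P a p i) (trans (cong (a *_) (degree-≤ R i D<i)) (ℤP.*-zeroʳ a))
  }
  where open ≡-Reasoning

reversal-negP : ∀ {D p r} → ScaledReversal D p r → ScaledReversal D (negP p) (negP r)
reversal-negP {p = p} {r} R = reversal-cong (reversal-·P (- 1ℤ) R) (≈-sym (negP≈-1·P p)) (≈-sym (negP≈-1·P r))

reversal-0∷ : ∀ {D p r} → ScaledReversal D p r → ScaledReversal (suc D) (0ℤ ∷ p) r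
reversal-0∷ {D} {p} {r} R = record
  { coeff-reversed = λ k k≤1+D → [ reversed k , top k ]′ (ℕP.m≤n⇒m<n∨m≡n k≤1+D)
  ; coeff-beyond   = λ k 1+D<k → coeff-beyond R k (ℕP.<-trans (ℕP.n<1+n D) 1+D<k)
  ; degree-≤       = λ { (suc i) (s≤s D<i) → degree-≤ R i D<i }
  }
  where
  reversed : ∀ k → k < suc D → coeff r k ≡ two^ k * coeff (0ℤ ∷ p) (suc D ∸ k)
  reversed k (s≤s k≤D) =
    trans (coeff-reversed R k k≤D) (cong (λ i → two^ k * coeff (0ℤ ∷ p) i) (sym (ℕP.+-∸-assoc 1 k≤D)))
  top : ∀ k → k ≡ suc D → coeff r k ≡ two^ k * coeff (0ℤ ∷ p) (suc D ∸ k)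
  top k refl = begin
    coeff r (suc D)                          ≡⟨ coeff-beyond R (suc D) (ℕP.n<1+n D) ⟩
    0ℤ                                       ≡⟨ ℤP.*-zeroʳ (two^ (suc D)) ⟨
    two^ (suc D) * 0ℤ                        ≡⟨ cong (λ i → two^ (suc D) * coeff (0ℤ ∷ p) i) (ℕP.n∸n≡0 D) ⟨
    two^ (suc D) * coeff (0ℤ ∷ p) (D ∸ D)    ∎
    where open ≡-Reasoning

data Offset (K : ℕ) : ℕ → Set where
  below : ∀ {k} → k < K → Offset K k
  above : ∀ k′ → Offset K (K ℕ.+ k′)

offset : ∀ K k → Offset K k
offset zero    k       = above k
offset (suc K) zero    = below (s≤s z≤n)
offset (suc K) (suc k) with offset K k
... | below k<K = below (s≤s k<K)
... | above k′  = above k′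

reversal-shift : ∀ K {D q s} → ScaledReversal D q s → ScaledReversal (K ℕ.+ D) q (shift K (two^ K ·P s))
reversal-shift K {D} {q} {s} S = record
  { coeff-reversed = λ k → reversed (offset K k)
  ; coeff-beyond   = λ k → beyond (offset K k)
  ; degree-≤       = λ i K+D<i → degree-≤ S i (ℕP.≤-<-trans (ℕP.m≤n+m D K) K+D<i)
  }
  where
  shifted : ∀ k′ → coeff (shift K (two^ K ·P s)) (K ℕ.+ k′) ≡ two^ K * coeff s k′
  shifted k′ = trans (coeff-shift-+ K (two^ K ·P s) k′) (coeff-·P (two^ K) s k′)
  reversed : ∀ {k} → Offset K k → k ≤ K ℕ.+ D → coeff (shift K (two^ K ·P s)) k ≡ two^ k * coeff q (K ℕ.+ D ∸ k)
  reversed {k} (below k<K) _ = begin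
    coeff (shift K (two^ K ·P s)) k   ≡⟨ coeff-shift-< K (two^ K ·P s) k<K ⟩
    0ℤ                                ≡⟨ ℤP.*-zeroʳ (two^ k) ⟨
    two^ k * 0ℤ                       ≡⟨ cong (two^ k *_) (degree-≤ S (K ℕ.+ D ∸ k) D<K+D∸k) ⟨
    two^ k * coeff q (K ℕ.+ D ∸ k)    ∎
    where
    open ≡-Reasoning
    D<K+D∸k : D < K ℕ.+ D ∸ k
    D<K+D∸k = subst (D <_) (sym (ℕP.+-∸-comm D (ℕP.<⇒≤ k<K))) (ℕP.+-monoˡ-< D (ℕP.m<n⇒0<n∸m k<K))
  reversed (above k′) K+k′≤K+D = begin
    coeff (shift K (two^ K ·P s)) (K ℕ.+ k′)
      ≡⟨ shifted k′ ⟩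
    two^ K * coeff s k′
      ≡⟨ cong (two^ K *_) (coeff-reversed S k′ (ℕP.+-cancelˡ-≤ K k′ D K+k′≤K+D)) ⟩
    two^ K * (two^ k′ * coeff q (D ∸ k′))
      ≡⟨ ℤP.*-assoc (two^ K) (two^ k′) _ ⟨
    two^ K * two^ k′ * coeff q (D ∸ k′)
      ≡⟨ cong₂ _*_ (two^-+ K k′) (cong (coeff q) (ℕP.[m+n]∸[m+o]≡n∸o K D k′)) ⟨
    two^ (K ℕ.+ k′) * coeff q (K ℕ.+ D ∸ (K ℕ.+ k′)) ∎
    where open ≡-Reasoning
  beyond : ∀ {k} → Offset K k → K ℕ.+ D < k → coeff (shift K (two^ K ·P s)) k ≡ 0ℤ
  beyond (below k<K)  _         = coeff-shift-< K (two^ K ·P s) k<K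
  beyond (above k′)   K+D<K+k′ =
    trans (shifted k′) (trans (cong (two^ K *_) (coeff-beyond S k′ (ℕP.+-cancelˡ-< K D k′ K+D<K+k′)))
                              (ℤP.*-zeroʳ (two^ K)))

coeff-applyUpTo-< : ∀ f n {k} → k < n → coeff (applyUpTo f n) k ≡ f k
coeff-applyUpTo-< f (suc n) {zero}  _         = refl
coeff-applyUpTo-< f (suc n) {suc k} (s≤s k<n) = coeff-applyUpTo-< (f ∘ suc) n k<n

coeff-applyUpTo-≥ : ∀ f n {k} → n ≤ k → coeff (applyUpTo f n) k ≡ 0ℤ
coeff-applyUpTo-≥ f zero    _         = refl
coeff-applyUpTo-≥ f (suc n) (s≤s n≤k) = coeff-applyUpTo-≥ (f ∘ suc) n n≤k

reversal : ℕ → Poly → Poly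
reversal D p = applyUpTo (λ k → two^ k * coeff p (D ∸ k)) (suc D)

reversal-exists : ∀ D p → (∀ i → D < i → coeff p i ≡ 0ℤ) → ScaledReversal D p (reversal D p)
reversal-exists D p deg≤D = record
  { coeff-reversed = λ k k≤D → coeff-applyUpTo-< (λ k → two^ k * coeff p (D ∸ k)) (suc D) (s≤s k≤D)
  ; coeff-beyond   = λ k D<k → coeff-applyUpTo-≥ (λ k → two^ k * coeff p (D ∸ k)) (suc D) D<k
  ; degree-≤       = deg≤D
  }

reversal-constant : ∀ a → ScaledReversal 0 (a ∷ []) (a ∷ [])
reversal-constant a = record
  { coeff-reversed = λ { zero _ → sym (ℤP.*-identityˡ a) }
  ; coeff-beyond   = λ { (suc k) _ → refl }
  ; degree-≤       = λ { (suc i) _ → refl }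
  }

-- Induction on p = a + x·p′: a contributes the top monomial (2y)^D₁·a of r, and
-- x·p′ has the same reversal at degree D₁ as p′ at degree D₁ - 1.
reversal-*P : ∀ {D₁ D₂ p q r s} → ScaledReversal D₁ p r → ScaledReversal D₂ q s →
              ScaledReversal (D₁ ℕ.+ D₂) (p *P q) (r *P s)
reversal-*P {p = []} {q} {r} {s} R S = reversal-of-[] (*P-zeroˡ s (reversal-[] R))
reversal-*P {zero} {p = a ∷ p} {q} {r} {s} R S = reversal-cong (reversal-·P a S) (≈-sym aq≈) (≈-sym rs≈)
  where
  p≈0 : p ≈ []
  p≈0 = coeffwise λ i → degree-≤ R (suc i) (s≤s z≤n)
  r≈a : r ≈ (a ∷ [])
  r≈a = coeffwise λ where
    zero    → trans (coeff-reversed R 0 z≤n) (ℤP.*-identityˡ a)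
    (suc k) → coeff-beyond R (suc k) (s≤s z≤n)
  aq≈ : ((a ∷ p) *P q) ≈ (a ·P q)
  aq≈ = +P-identityʳ (a ·P q) (≈-trans (∷-cong 0ℤ (*P-zeroˡ q p≈0)) 0∷[]≈[])
  rs≈ : (r *P s) ≈ (a ·P s)
  rs≈ = ≈-trans (*P-cong r≈a (≈-refl {s})) (singleton-*P a s)
reversal-*P {suc D₁} {D₂} {a ∷ p} {q} {r} {s} R S = reversal-cong combined ≈-refl (≈-sym rs≈)
  where
  K = suc D₁
  lead = two^ K * a
  r′ = reversal D₁ p
  R′ : ScaledReversal D₁ p r′
  R′ = reversal-exists D₁ p (λ i D₁<i → degree-≤ R (suc i) (s≤s D₁<i))
  combined : ScaledReversal (K ℕ.+ D₂) ((a ·P q) +P (0ℤ ∷ (p *P q))) (shift K (two^ K ·P (a ·P s)) +P (r′ *P s))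
  combined = reversal-+P (reversal-shift K (reversal-·P a S)) (reversal-0∷ (reversal-*P R′ S))
  leading : ScaledReversal K (a ∷ []) (shift K (lead ∷ []))
  leading = subst (λ E → ScaledReversal E (a ∷ []) (shift K (lead ∷ []))) (ℕP.+-identityʳ K)
                  (reversal-shift K (reversal-constant a))
  a∷p≈ : ((a ∷ []) +P (0ℤ ∷ p)) ≈ (a ∷ p)
  a∷p≈ = coeffwise λ where
    zero    → ℤP.+-identityʳ a
    (suc i) → refl
  r≈ : r ≈ (shift K (lead ∷ []) +P r′)
  r≈ = reversal-unique R (reversal-cong (reversal-+P leading (reversal-0∷ R′)) a∷p≈ ≈-refl)
  rs≈ : (r *P s) ≈ (shift K (two^ K ·P (a ·P s)) +P (r′ *P s))
  rs≈ = begin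
    r *P s                                       ≈⟨ *P-cong r≈ (≈-refl {s}) ⟩
    (shift K (lead ∷ []) +P r′) *P s             ≈⟨ *P-distribʳ (shift K (lead ∷ [])) r′ s ⟩
    (shift K (lead ∷ []) *P s) +P (r′ *P s)      ≈⟨ +P-cong (shift-*P K (lead ∷ []) s) (≈-refl {r′ *P s}) ⟩
    shift K ((lead ∷ []) *P s) +P (r′ *P s)      ≈⟨ +P-cong (shift-cong K lead·s) (≈-refl {r′ *P s}) ⟩
    shift K (two^ K ·P (a ·P s)) +P (r′ *P s)    ∎
    where
    open ≈-Reasoning
    lead·s : ((lead ∷ []) *P s) ≈ (two^ K ·P (a ·P s))
    lead·s = ≈-trans (singleton-*P lead s) (≈-sym (·P-·P (two^ K) a s))

reversal-^P : ∀ d {D p r} → ScaledReversal D p r → ScaledReversal (d ℕ.* D) (p ^P d) (r ^P d)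
reversal-^P zero    R = reversal-constant 1ℤ
reversal-^P (suc d) R = reversal-*P R (reversal-^P d R)

infix 4 _≈_mod_
record _≈_mod_ (p q : Poly) (m : ℤ) : Set where
  constructor coeffwise-∣
  field coeff-∣ : ∀ i → m ∣ℤ coeff p i - coeff q i
open _≈_mod_ public

≈⇒≈mod : ∀ {p q m} → p ≈ q → p ≈ q mod m
≈⇒≈mod {p} {q} {m} p≈q = coeffwise-∣ λ i →
  subst (m ∣ℤ_) (sym (trans (cong (_- coeff q i) (coeff-≡ p≈q i)) (ℤP.+-inverseʳ (coeff q i))))
        (divides 0ℤ refl)

≈mod-refl : ∀ {p m} → p ≈ p mod m
≈mod-refl = ≈⇒≈mod ≈-refl

≈mod-trans : ∀ {p q r m} → p ≈ q mod m → q ≈ r mod m → p ≈ r mod m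
≈mod-trans {p} {q} {r} p≈q q≈r = coeffwise-∣ λ i →
  subst (_ ∣ℤ_) (lemma (coeff p i) (coeff q i) (coeff r i)) (ℤ∣.∣m∣n⇒∣m+n (coeff-∣ p≈q i) (coeff-∣ q≈r i))
  where
  lemma : ∀ a b c → (a - b) + (b - c) ≡ a - c
  lemma = solve-∀

≈mod-weaken : ∀ {p q m m′} → m′ ∣ℤ m → p ≈ q mod m → p ≈ q mod m′
≈mod-weaken m′∣m p≈q = coeffwise-∣ λ i → ℤ∣.∣-trans m′∣m (coeff-∣ p≈q i)

*P-≈mod : ∀ {p p′ q q′ m} → p ≈ p′ mod m → q ≈ q′ mod m → (p *P q) ≈ (p′ *P q′) mod m
*P-≈mod {p} {p′} {q} {q′} {m} p≈p′ q≈q′ = coeffwise-∣ λ n →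
  subst (m ∣ℤ_) (sym (difference n)) (∣-sum (λ i → convolution p q n i - convolution p′ q′ n i) (termwise n))
  where
  difference : ∀ n → coeff (p *P q) n - coeff (p′ *P q′) n
                   ≡ sum (λ i → convolution p q n i - convolution p′ q′ n i)
  difference n = trans (cong₂ _-_ (coeff-*P p q n) (coeff-*P p′ q′ n))
                       (∑-distrib-- (convolution p q n) (convolution p′ q′ n))
  product-rule : ∀ a a′ b b′ → a * b - a′ * b′ ≡ (a - a′) * b + a′ * (b - b′)
  product-rule = solve-∀
  termwise : ∀ n i → m ∣ℤ convolution p q n i - convolution p′ q′ n i
  termwise n i = subst (m ∣ℤ_) (sym (product-rule (coeff p i′) (coeff p′ i′) (coeff q j) (coeff q′ j)))
    (ℤ∣.∣m∣n⇒∣m+n (ℤ∣.∣m⇒∣m*n (coeff q j) (coeff-∣ p≈p′ i′)) (ℤ∣.∣n⇒∣m*n (coeff p′ i′) (coeff-∣ q≈q′ j)))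
    where
    i′ = toℕ i
    j = n ∸ toℕ i

subtract-multiple-≈mod : ∀ p {q m} → (∀ i → m ∣ℤ coeff q i) → (p +P negP q) ≈ p mod m
subtract-multiple-≈mod p {q} {m} m∣q = coeffwise-∣ λ i → subst (m ∣ℤ_) (sym (difference i)) (ℤ∣.∣m⇒∣-m (m∣q i))
  where
  difference : ∀ i → coeff (p +P negP q) i - coeff p i ≡ - coeff q i
  difference i = trans (cong (_- coeff p i) (coeff-+P-negP p q i)) (lemma (coeff p i) (coeff q i))
    where
    lemma : ∀ a b → (a - b) - a ≡ - b
    lemma = solve-∀

^P-≈mod : ∀ {p q m} d → p ≈ q mod m → (p ^P d) ≈ (q ^P d) mod m
^P-≈mod zero    p≈q = ≈mod-refl
^P-≈mod (suc d) p≈q = *P-≈mod p≈q (^P-≈mod d p≈q)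

≈mod-respˡ : ∀ {p p′ q m} → p ≈ p′ → p ≈ q mod m → p′ ≈ q mod m
≈mod-respˡ p≈p′ = ≈mod-trans (≈⇒≈mod (≈-sym p≈p′))

∣-*-∣ : ∀ {a b x y} → a ∣ℤ x → b ∣ℤ y → a * b ∣ℤ x * y
∣-*-∣ {a} {b} (divides q refl) (divides q′ refl) = divides (q * q′) (lemma q a q′ b)
  where
  lemma : ∀ q a q′ b → (q * a) * (q′ * b) ≡ (q * q′) * (a * b)
  lemma = solve-∀

coeff-∣-*P : ∀ {m m′ p q} → (∀ i → m ∣ℤ coeff p i) → (∀ i → m′ ∣ℤ coeff q i) →
             ∀ n → m * m′ ∣ℤ coeff (p *P q) n
coeff-∣-*P {m} {m′} {p} {q} m∣p m′∣q n = subst (m * m′ ∣ℤ_) (sym (coeff-*P p q n))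
  (∣-sum (convolution p q n) λ i → ∣-*-∣ (m∣p (toℕ i)) (m′∣q (n ∸ toℕ i)))

-- With p = 1 + h and 2^r dividing h, p² - 1 = 2h + h² is divisible by 2^(r+1).
square-≈1 : ∀ r {p} → 1 ≤ r → p ≈ 1P mod two^ r → (p *P p) ≈ 1P mod two^ (suc r)
square-≈1 r {p} 1≤r p≈1 = coeffwise-∣ λ i → subst (two^ (suc r) ∣ℤ_) (sym (difference i))
  (ℤ∣.∣m∣n⇒∣m+n (twice (h-divisible i)) (ℤ∣.∣-trans (two^-∣ r+1≤r+r) (h²-divisible i)))
  where
  h = p +P negP 1P
  h-divisible : ∀ i → two^ r ∣ℤ coeff h i
  h-divisible i = subst (two^ r ∣ℤ_) (sym (coeff-+P-negP p 1P i)) (coeff-∣ p≈1 i)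
  h²-divisible : ∀ i → two^ (r ℕ.+ r) ∣ℤ coeff (h *P h) i
  h²-divisible i = subst (_∣ℤ coeff (h *P h) i) (sym (two^-+ r r)) (coeff-∣-*P {p = h} {q = h} h-divisible h-divisible i)
  r+1≤r+r : suc r ≤ r ℕ.+ r
  r+1≤r+r = subst (_≤ r ℕ.+ r) (ℕP.+-comm r 1) (ℕP.+-monoʳ-≤ r 1≤r)
  twice : ∀ {x} → two^ r ∣ℤ x → two^ (suc r) ∣ℤ x + x
  twice {x} (divides q refl) = divides q (trans (lemma q (two^ r)) (cong (q *_) (sym (ℤP.pos-* 2 (2 ^ r)))))
    where
    lemma : ∀ q t → q * t + q * t ≡ q * (+ 2 * t)
    lemma = solve-∀
  expand : (p *P p) ≈ ((1P +P h) +P (h +P (h *P h)))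
  expand = begin
    p *P p
      ≈⟨ *P-cong p≈1+h p≈1+h ⟩
    (1P +P h) *P (1P +P h)
      ≈⟨ *P-distribʳ 1P h (1P +P h) ⟩
    (1P *P (1P +P h)) +P (h *P (1P +P h))
      ≈⟨ +P-cong (*P-identityˡ (1P +P h)) (*P-distribˡ h 1P h) ⟩
    (1P +P h) +P ((h *P 1P) +P (h *P h))
      ≈⟨ +P-cong (≈-refl {1P +P h}) (+P-cong (*P-identityʳ h) (≈-refl {h *P h})) ⟩
    (1P +P h) +P (h +P (h *P h)) ∎
    where
    open ≈-Reasoning
    p≈1+h : p ≈ (1P +P h)
    p≈1+h = coeffwise λ i → trans (lemma (coeff p i) (coeff 1P i))
      (sym (trans (coeff-+P 1P h i) (cong (_+_ (coeff 1P i)) (coeff-+P-negP p 1P i))))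
      where
      lemma : ∀ a b → a ≡ b + (a - b)
      lemma = solve-∀
  difference : ∀ i → coeff (p *P p) i - coeff 1P i ≡ (coeff h i + coeff h i) + coeff (h *P h) i
  difference i = begin
    coeff (p *P p) i - coeff 1P i
      ≡⟨ cong (_- coeff 1P i) (coeff-≡ expand i) ⟩
    coeff ((1P +P h) +P (h +P (h *P h))) i - coeff 1P i
      ≡⟨ cong (_- coeff 1P i) (trans (coeff-+P (1P +P h) _ i)
                                     (cong₂ _+_ (coeff-+P 1P h i) (coeff-+P h (h *P h) i))) ⟩
    ((coeff 1P i + coeff h i) + (coeff h i + coeff (h *P h) i)) - coeff 1P i
      ≡⟨ lemma (coeff 1P i) (coeff h i) (coeff (h *P h) i) ⟩
    (coeff h i + coeff h i) + coeff (h *P h) i ∎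
    where
    open ≡-Reasoning
    lemma : ∀ o x y → ((o + x) + (x + y)) - o ≡ (x + x) + y
    lemma = solve-∀

^2^-≈1 : ∀ s r {p} → 1 ≤ r → p ≈ 1P mod two^ r → (p ^P (2 ^ s)) ≈ 1P mod two^ (s ℕ.+ r)
^2^-≈1 zero    r {p} 1≤r p≈1 = ≈mod-respˡ (≈-sym (*P-identityʳ p)) p≈1
^2^-≈1 (suc s) r {p} 1≤r p≈1 =
  ≈mod-respˡ (≈-sym halves) (square-≈1 (s ℕ.+ r) (ℕP.≤-trans 1≤r (ℕP.m≤n+m r s)) (^2^-≈1 s r 1≤r p≈1))
  where
  halves : (p ^P (2 ^ suc s)) ≈ ((p ^P (2 ^ s)) *P (p ^P (2 ^ s)))
  halves = ≈-trans (≡⇒≈ (cong (λ e → p ^P (2 ^ s ℕ.+ e)) (ℕP.+-identityʳ (2 ^ s)))) (^P-+ p (2 ^ s) (2 ^ s))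

absorption : ∀ n k → suc k ℕ.* (suc n C suc k) ≡ suc n ℕ.* (n C k)
absorption zero    zero    = refl
absorption zero    (suc k) = ℕP.*-zeroʳ (suc (suc k))
absorption (suc n) zero    = trans (ℕP.*-identityˡ _) (trans (nC1≡n (suc (suc n))) (sym (ℕP.*-identityʳ _)))
absorption (suc n) (suc k) = begin
  suc (suc k) ℕ.* (suc (suc n) C suc (suc k))
    ≡⟨ cong (suc (suc k) ℕ.*_) (nCk+nC[k+1]≡[n+1]C[k+1] (suc n) (suc k)) ⟨
  suc (suc k) ℕ.* (suc n C suc k ℕ.+ suc n C suc (suc k))
    ≡⟨ split-factor (suc k) (suc n C suc k) (suc n C suc (suc k)) ⟩
  suc k ℕ.* (suc n C suc k) ℕ.+ suc n C suc k ℕ.+ suc (suc k) ℕ.* (suc n C suc (suc k))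
    ≡⟨ cong₂ (λ x y → x ℕ.+ suc n C suc k ℕ.+ y) (absorption n k) (absorption n (suc k)) ⟩
  suc n ℕ.* (n C k) ℕ.+ suc n C suc k ℕ.+ suc n ℕ.* (n C suc k)
    ≡⟨ join-factor (suc n) (n C k) (n C suc k) (suc n C suc k) ⟩
  suc n ℕ.* (n C k ℕ.+ n C suc k) ℕ.+ suc n C suc k
    ≡⟨ cong (λ x → suc n ℕ.* x ℕ.+ suc n C suc k) (nCk+nC[k+1]≡[n+1]C[k+1] n k) ⟩
  suc n ℕ.* (suc n C suc k) ℕ.+ suc n C suc k
    ≡⟨ ℕP.+-comm (suc n ℕ.* (suc n C suc k)) _ ⟩
  suc (suc n) ℕ.* (suc n C suc k) ∎
  where
  open ≡-Reasoning
  split-factor : ∀ a x y → suc a ℕ.* (x ℕ.+ y) ≡ a ℕ.* x ℕ.+ x ℕ.+ suc a ℕ.* y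
  split-factor = ℕ-solve-∀
  join-factor : ∀ a x y z → a ℕ.* x ℕ.+ z ℕ.+ a ℕ.* y ≡ a ℕ.* (x ℕ.+ y) ℕ.+ z
  join-factor = ℕ-solve-∀

data Parity (n : ℕ) : Set where
  even : ∀ h → n ≡ h ℕ.+ h → Parity n
  odd  : ∀ h → n ≡ suc (h ℕ.+ h) → Parity n

parity : ∀ n → Parity n
parity zero = even 0 refl
parity (suc n) with parity n
... | even h n≡h+h = odd h (cong suc n≡h+h)
... | odd  h n≡1+h+h = even (suc h) (cong suc (trans n≡1+h+h (sym (ℕP.+-suc h h))))

2∣odd*⇒2∣ : ∀ h X → 2 ∣ suc (h ℕ.+ h) ℕ.* X → 2 ∣ X
2∣odd*⇒2∣ h X 2∣ = ℕ∣.∣m+n∣m⇒∣n (subst (2 ∣_) (ℕP.+-comm X ((h ℕ.+ h) ℕ.* X)) 2∣)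
                               (subst (2 ∣_) (sym (double h X)) (ℕ∣.n∣m*n (h ℕ.* X)))
  where
  double : ∀ h X → (h ℕ.+ h) ℕ.* X ≡ h ℕ.* X ℕ.* 2
  double = ℕ-solve-∀

2^∣odd*⇒2^∣ : ∀ m h X → 2 ^ m ∣ suc (h ℕ.+ h) ℕ.* X → 2 ^ m ∣ X
2^∣odd*⇒2^∣ zero    h X _ = ℕ∣.1∣ X
2^∣odd*⇒2^∣ (suc m) h X 2^[1+m]∣ with 2∣odd*⇒2∣ h X (ℕ∣.∣-trans (ℕ∣.m∣m*n (2 ^ m)) 2^[1+m]∣)
... | divides q refl = subst (2 ^ suc m ∣_) (ℕP.*-comm 2 q) (ℕ∣.*-monoʳ-∣ 2 (2^∣odd*⇒2^∣ m h q 2^m∣))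
  where
  regroup : ∀ h q → suc (h ℕ.+ h) ℕ.* (q ℕ.* 2) ≡ 2 ℕ.* (suc (h ℕ.+ h) ℕ.* q)
  regroup = ℕ-solve-∀
  2^m∣ : 2 ^ m ∣ suc (h ℕ.+ h) ℕ.* q
  2^m∣ = ℕ∣.*-cancelˡ-∣ 2 (subst (2 ℕ.* 2 ^ m ∣_) (regroup h q) 2^[1+m]∣)

-- The proof rests on ν₂(i) < i: an odd factor is cancelled outright, and an even
-- factor 2h is traded for 2^(h+1), which divides 2^(2h).
2^∣[1+i]*⇒2^∣2^[1+i]* : ∀ m i X → 2 ^ m ∣ suc i ℕ.* X → 2 ^ m ∣ 2 ^ suc i ℕ.* X
2^∣[1+i]*⇒2^∣2^[1+i]* m = <-rec Goal step
  where
  Goal : ℕ → Set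
  Goal i = ∀ X → 2 ^ m ∣ suc i ℕ.* X → 2 ^ m ∣ 2 ^ suc i ℕ.* X
  step : ∀ i → (∀ {j} → j < i → Goal j) → Goal i
  step i rec X 2^m∣ with parity (suc i)
  ... | odd h refl = ℕ∣.∣n⇒∣m*n (2 ^ suc i) (2^∣odd*⇒2^∣ m h X 2^m∣)
  ... | even zero ()
  ... | even (suc h) refl = ℕ∣.∣-trans 2^m∣2^[2+h]X (ℕ∣.*-monoˡ-∣ X (2^-∣ (s≤s (ℕP.m≤n+m (suc h) h))))
    where
    regroup : ∀ h X → (suc h ℕ.+ suc h) ℕ.* X ≡ suc h ℕ.* (2 ℕ.* X)
    regroup = ℕ-solve-∀
    reassoc : 2 ^ suc h ℕ.* (2 ℕ.* X) ≡ 2 ^ suc (suc h) ℕ.* X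
    reassoc = trans (sym (ℕP.*-assoc (2 ^ suc h) 2 X)) (cong (ℕ._* X) (ℕP.*-comm (2 ^ suc h) 2))
    2^m∣2^[2+h]X : 2 ^ m ∣ 2 ^ suc (suc h) ℕ.* X
    2^m∣2^[2+h]X = subst (2 ^ m ∣_) reassoc
                         (rec (ℕP.m<m+n h (s≤s z≤n)) (2 ℕ.* X) (subst (2 ^ m ∣_) (regroup h X) 2^m∣))

2^∣2^j*C : ∀ m j → 2 ^ m ∣ 2 ^ suc j ℕ.* (2 ^ m C suc j)
2^∣2^j*C m j = 2^∣[1+i]*⇒2^∣2^[1+i]* m j (2 ^ m C suc j)
  (subst (λ M → M ∣ suc j ℕ.* (M C suc j)) (1+[2^m∸1]≡2^m m)
         (divides ((2 ^ m ∸ 1) C j) (trans (absorption (2 ^ m ∸ 1) j) (ℕP.*-comm (suc (2 ^ m ∸ 1)) _))))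

pascal-∸ : ∀ N j → (N ∸ j) C suc j ℕ.+ (N ∸ j) C j ≡ (suc N ∸ j) C suc j
pascal-∸ N j with ℕP.≤-<-connex j N
... | inj₁ j≤N = begin
  (N ∸ j) C suc j ℕ.+ (N ∸ j) C j  ≡⟨ ℕP.+-comm _ ((N ∸ j) C j) ⟩
  (N ∸ j) C j ℕ.+ (N ∸ j) C suc j  ≡⟨ nCk+nC[k+1]≡[n+1]C[k+1] (N ∸ j) j ⟩
  suc (N ∸ j) C suc j              ≡⟨ cong (_C suc j) (ℕP.+-∸-assoc 1 j≤N) ⟨
  (suc N ∸ j) C suc j              ∎
  where open ≡-Reasoning
... | inj₂ N<j = begin
  (N ∸ j) C suc j ℕ.+ (N ∸ j) C j  ≡⟨ cong (λ n → n C suc j ℕ.+ n C j) (ℕP.m≤n⇒m∸n≡0 (ℕP.<⇒≤ N<j)) ⟩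
  0 C suc j ℕ.+ 0 C j              ≡⟨ k>n⇒nCk≡0 (ℕP.≤-<-trans z≤n N<j) ⟩
  0                                ≡⟨ cong (_C suc j) (ℕP.m≤n⇒m∸n≡0 N<j) ⟨
  (suc N ∸ j) C suc j              ∎
  where open ≡-Reasoning

two^∣two^j*ΔC : ∀ m j x → two^ m ∣ℤ two^ j * (+ ((x ℕ.+ 2 ^ m) C j) - + (x C j))
two^∣two^j*ΔC m zero    x       = divides 0ℤ refl
two^∣two^j*ΔC m (suc j) zero    = subst (two^ m ∣ℤ_) from-ℕ (ℤ∣.∣ᵤ⇒∣ (2^∣2^j*C m j))
  where
  from-ℕ : + (2 ^ suc j ℕ.* (2 ^ m C suc j)) ≡ two^ (suc j) * (+ (2 ^ m C suc j) - + 0)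
  from-ℕ = trans (ℤP.pos-* (2 ^ suc j) _) (cong (two^ (suc j) *_) (sym (ℤP.+-identityʳ _)))
two^∣two^j*ΔC m (suc j) (suc x) = subst (two^ m ∣ℤ_) (sym pascal-step)
  (ℤ∣.∣m∣n⇒∣m+n (ℤ∣.∣n⇒∣m*n (+ 2) (two^∣two^j*ΔC m j x)) (two^∣two^j*ΔC m (suc j) x))
  where
  a₀ = (x ℕ.+ 2 ^ m) C j
  a₁ = (x ℕ.+ 2 ^ m) C suc j
  b₀ = x C j
  b₁ = x C suc j
  regroup : ∀ t a₀ a₁ b₀ b₁ → (+ 2 * t) * ((a₀ + a₁) - (b₀ + b₁)) ≡ + 2 * (t * (a₀ - b₀)) + (+ 2 * t) * (a₁ - b₁)
  regroup = solve-∀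
  pascal-step : two^ (suc j) * (+ (suc (x ℕ.+ 2 ^ m) C suc j) - + (suc x C suc j))
              ≡ + 2 * (two^ j * (+ a₀ - + b₀)) + two^ (suc j) * (+ a₁ - + b₁)
  pascal-step = begin
    two^ (suc j) * (+ (suc (x ℕ.+ 2 ^ m) C suc j) - + (suc x C suc j))
      ≡⟨ cong₂ (λ u v → two^ (suc j) * (+ u - + v))
               (nCk+nC[k+1]≡[n+1]C[k+1] (x ℕ.+ 2 ^ m) j) (nCk+nC[k+1]≡[n+1]C[k+1] x j) ⟨
    two^ (suc j) * (+ (a₀ ℕ.+ a₁) - + (b₀ ℕ.+ b₁))
      ≡⟨ cong₂ _*_ (ℤP.pos-* 2 (2 ^ j)) (cong₂ _-_ (ℤP.pos-+ a₀ a₁) (ℤP.pos-+ b₀ b₁)) ⟩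
    (+ 2 * two^ j) * ((+ a₀ + + a₁) - (+ b₀ + + b₁))
      ≡⟨ regroup (two^ j) (+ a₀) (+ a₁) (+ b₀) (+ b₁) ⟩
    + 2 * (two^ j * (+ a₀ - + b₀)) + (+ 2 * two^ j) * (+ a₁ - + b₁)
      ≡⟨ cong (λ t → + 2 * (two^ j * (+ a₀ - + b₀)) + t * (+ a₁ - + b₁)) (ℤP.pos-* 2 (2 ^ j)) ⟨
    + 2 * (two^ j * (+ a₀ - + b₀)) + two^ (suc j) * (+ a₁ - + b₁) ∎
    where open ≡-Reasoning

-- The scaled reversal of p_N: reversing p_(N+2) = x·p_(N+1) - p_N gives
-- r_(N+2) = r_(N+1) - 4y²·r_N.
revPath : ℕ → Poly
revPath zero          = 1P
revPath (suc zero)    = 1P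
revPath (suc (suc N)) = revPath (suc N) +P negP (shift 2 (two^ 2 ·P revPath N))

reversal-path : ∀ N → ScaledReversal N (pathPoly N) (revPath N)
reversal-path zero          = reversal-constant 1ℤ
reversal-path (suc zero)    = reversal-0∷ (reversal-constant 1ℤ)
reversal-path (suc (suc N)) =
  reversal-+P (reversal-0∷ (reversal-path (suc N))) (reversal-negP (reversal-shift 2 (reversal-path N)))

coeff-revPath-<2 : ∀ N {k} → k < 2 → coeff (revPath (suc (suc N))) k ≡ coeff (revPath (suc N)) k
coeff-revPath-<2 N {k} k<2 = begin
  coeff (revPath (suc (suc N))) k
    ≡⟨ coeff-+P-negP (revPath (suc N)) _ k ⟩
  coeff (revPath (suc N)) k - coeff (shift 2 (two^ 2 ·P revPath N)) k
    ≡⟨ cong (_-_ (coeff (revPath (suc N)) k)) (coeff-shift-< 2 _ k<2) ⟩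
  coeff (revPath (suc N)) k - 0ℤ
    ≡⟨ ℤP.+-identityʳ _ ⟩
  coeff (revPath (suc N)) k ∎
  where open ≡-Reasoning

coeff-revPath-2+ : ∀ N i → coeff (revPath (suc (suc N))) (suc (suc i))
                         ≡ coeff (revPath (suc N)) (suc (suc i)) - + 4 * coeff (revPath N) i
coeff-revPath-2+ N i = trans (coeff-+P-negP (revPath (suc N)) (shift 2 (two^ 2 ·P revPath N)) (suc (suc i)))
                             (cong (_-_ (coeff (revPath (suc N)) (suc (suc i)))) (coeff-·P (+ 4) (revPath N) i))

coeff-revPath-odd : ∀ N j → coeff (revPath N) (suc (j ℕ.+ j)) ≡ 0ℤ
coeff-revPath-odd zero          j       = refl
coeff-revPath-odd (suc zero)    j       = refl
coeff-revPath-odd (suc (suc N)) zero    = trans (coeff-revPath-<2 N (s≤s (s≤s z≤n))) (coeff-revPath-odd (suc N) 0)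
coeff-revPath-odd (suc (suc N)) (suc j) = begin
  coeff (revPath (suc (suc N))) (suc (suc j ℕ.+ suc j))
    ≡⟨ cong (coeff (revPath (suc (suc N)))) 3+2j ⟩
  coeff (revPath (suc (suc N))) (suc (suc (suc (j ℕ.+ j))))
    ≡⟨ coeff-revPath-2+ N (suc (j ℕ.+ j)) ⟩
  coeff (revPath (suc N)) (suc (suc (suc (j ℕ.+ j)))) - + 4 * coeff (revPath N) (suc (j ℕ.+ j))
    ≡⟨ cong₂ (λ u v → u - + 4 * v) (trans (cong (coeff (revPath (suc N))) (sym 3+2j)) (coeff-revPath-odd (suc N) (suc j)))
                                    (coeff-revPath-odd N j) ⟩
  0ℤ ∎
  where
  open ≡-Reasoning
  3+2j : suc (suc j ℕ.+ suc j) ≡ suc (suc (suc (j ℕ.+ j)))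
  3+2j = cong (suc ∘ suc) (ℕP.+-suc j j)

coeff-revPath-even : ∀ N j → coeff (revPath N) (j ℕ.+ j) ≡ (- + 4) ℤ.^ j * + ((N ∸ j) C j)
coeff-revPath-even zero          zero    = refl
coeff-revPath-even (suc zero)    zero    = refl
coeff-revPath-even (suc (suc N)) zero    = trans (coeff-revPath-<2 N (s≤s z≤n)) (coeff-revPath-even (suc N) 0)
coeff-revPath-even zero          (suc j) =
  trans (cong (coeff 1P) (ℕP.+-suc (suc j) j)) (sym (ℤP.*-zeroʳ ((- + 4) ℤ.^ suc j)))
coeff-revPath-even (suc zero)    (suc j) = trans (cong (coeff 1P) (ℕP.+-suc (suc j) j)) (sym (begin
  (- + 4) ℤ.^ suc j * + ((1 ∸ suc j) C suc j)  ≡⟨ cong (λ n → (- + 4) ℤ.^ suc j * + (n C suc j)) (ℕP.0∸n≡0 j) ⟩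
  (- + 4) ℤ.^ suc j * 0ℤ                       ≡⟨ ℤP.*-zeroʳ ((- + 4) ℤ.^ suc j) ⟩
  0ℤ                                           ∎))
  where open ≡-Reasoning
coeff-revPath-even (suc (suc N)) (suc j) = begin
  coeff (revPath (suc (suc N))) (suc j ℕ.+ suc j)
    ≡⟨ cong (coeff (revPath (suc (suc N)))) 2+2j ⟩
  coeff (revPath (suc (suc N))) (suc (suc (j ℕ.+ j)))
    ≡⟨ coeff-revPath-2+ N (j ℕ.+ j) ⟩
  coeff (revPath (suc N)) (suc (suc (j ℕ.+ j))) - + 4 * coeff (revPath N) (j ℕ.+ j)
    ≡⟨ cong₂ (λ u v → u - + 4 * v) (trans (cong (coeff (revPath (suc N))) (sym 2+2j)) (coeff-revPath-even (suc N) (suc j)))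
                                    (coeff-revPath-even N j) ⟩
  (- + 4) * e * + B₁ - + 4 * (e * + B₀)
    ≡⟨ regroup e (+ B₁) (+ B₀) ⟩
  (- + 4) ℤ.^ suc j * (+ B₁ + + B₀)
    ≡⟨ cong ((- + 4) ℤ.^ suc j *_) (trans (sym (ℤP.pos-+ B₁ B₀)) (cong +_ (pascal-∸ N j))) ⟩
  (- + 4) ℤ.^ suc j * + ((suc (suc N) ∸ suc j) C suc j) ∎
  where
  open ≡-Reasoning
  e = (- + 4) ℤ.^ j
  B₀ = (N ∸ j) C j
  B₁ = (N ∸ j) C suc j
  2+2j : suc j ℕ.+ suc j ≡ suc (suc (j ℕ.+ j))
  2+2j = cong suc (ℕP.+-suc j j)
  regroup : ∀ e b₁ b₀ → (- + 4) * e * b₁ - + 4 * (e * b₀) ≡ (- + 4) * e * (b₁ + b₀)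
  regroup = solve-∀

∣-coeff-shift-·P : ∀ K a p i → a ∣ℤ coeff (shift K (a ·P p)) i
∣-coeff-shift-·P K a p i with offset K i
... | below i<K = subst (a ∣ℤ_) (sym (coeff-shift-< K (a ·P p) i<K)) (divides 0ℤ refl)
... | above i′  = subst (a ∣ℤ_) (sym (trans (coeff-shift-+ K (a ·P p) i′) (coeff-·P a p i′)))
                        (ℤ∣.∣m⇒∣m*n (coeff p i′) ℤ∣.∣-refl)

revPath-≈1 : ∀ N → revPath N ≈ 1P mod two^ 2
revPath-≈1 zero          = ≈mod-refl
revPath-≈1 (suc zero)    = ≈mod-refl
revPath-≈1 (suc (suc N)) =
  ≈mod-trans (subtract-multiple-≈mod (revPath (suc N)) (∣-coeff-shift-·P 2 (two^ 2) (revPath N))) (revPath-≈1 (suc N))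

[-4]^j-divisible : ∀ j → two^ (j ℕ.+ j) ∣ℤ (- + 4) ℤ.^ j
[-4]^j-divisible zero    = ℤ∣.∣-refl
[-4]^j-divisible (suc j) = subst (_∣ℤ (- + 4) ℤ.^ suc j) 4*two^[j+j]≡two^[2+2j] (∣-*-∣ 4∣-4 ([-4]^j-divisible j))
  where
  4∣-4 : + 4 ∣ℤ - + 4
  4∣-4 = divides (- 1ℤ) refl
  4*two^[j+j]≡two^[2+2j] : + 4 * two^ (j ℕ.+ j) ≡ two^ (suc j ℕ.+ suc j)
  4*two^[j+j]≡two^[2+2j] = sym (trans (cong two^ (cong suc (ℕP.+-suc j j))) (two^-+ 2 (j ℕ.+ j)))

-- The even coefficients differ by (-4)^j (C(a-j, j) - C(a+2^m-j, j)): for j ≤ a the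
-- binomial difference times 2^j is divisible by 2^m, and for j > a already
-- (-4)^j is divisible by 2^(2j) ≥ 2^E.
revPath-periodic : ∀ E m a → E ≤ m → E ≤ suc a ℕ.+ suc a → revPath a ≈ revPath (a ℕ.+ 2 ^ m) mod two^ E
revPath-periodic E m a E≤m E≤2a+2 = coeffwise-∣ λ i → by-parity (parity i)
  where
  M = 2 ^ m
  near far : ℕ → ℤ
  near j = + ((a ∸ j) C j)
  far  j = + ((a ℕ.+ M ∸ j) C j)
  even-difference : ∀ j → coeff (revPath a) (j ℕ.+ j) - coeff (revPath (a ℕ.+ M)) (j ℕ.+ j)
                        ≡ (- + 4) ℤ.^ j * (near j - far j)
  even-difference j = trans (cong₂ _-_ (coeff-revPath-even a j) (coeff-revPath-even (a ℕ.+ M) j))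
                            (factor ((- + 4) ℤ.^ j) (near j) (far j))
    where
    factor : ∀ e x y → e * x - e * y ≡ e * (x - y)
    factor = solve-∀
  small : ∀ j → j ≤ a → two^ E ∣ℤ (- + 4) ℤ.^ j * (near j - far j)
  small j j≤a with [-4]^j-divisible j
  ... | divides q [-4]^j≡q*two^[j+j] = subst (two^ E ∣ℤ_) (sym rearranged)
        (ℤ∣.∣-trans (two^-∣ E≤m) (ℤ∣.∣n⇒∣m*n (- (q * two^ j)) (two^∣two^j*ΔC m j (a ∸ j))))
    where
    far′ = + ((a ∸ j ℕ.+ M) C j)
    regroup : ∀ q t b b′ → q * (t * t) * (b - b′) ≡ (- (q * t)) * (t * (b′ - b))
    regroup = solve-∀
    rearranged : (- + 4) ℤ.^ j * (near j - far j) ≡ (- (q * two^ j)) * (two^ j * (far′ - near j))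
    rearranged = begin
      (- + 4) ℤ.^ j * (near j - far j)
        ≡⟨ cong₂ (λ e n → e * (near j - + (n C j))) [-4]^j≡q*two^[j+j] (ℕP.+-∸-comm M j≤a) ⟩
      q * two^ (j ℕ.+ j) * (near j - far′)
        ≡⟨ cong (λ t → q * t * (near j - far′)) (two^-+ j j) ⟩
      q * (two^ j * two^ j) * (near j - far′)
        ≡⟨ regroup q (two^ j) (near j) far′ ⟩
      (- (q * two^ j)) * (two^ j * (far′ - near j)) ∎
      where open ≡-Reasoning
  large : ∀ j → a < j → two^ E ∣ℤ (- + 4) ℤ.^ j * (near j - far j)
  large j a<j = ℤ∣.∣m⇒∣m*n (near j - far j) (ℤ∣.∣-trans (two^-∣ E≤2j) ([-4]^j-divisible j))
    where
    E≤2j : E ≤ j ℕ.+ j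
    E≤2j = ℕP.≤-trans E≤2a+2 (ℕP.+-mono-≤ a<j a<j)
  by-parity : ∀ {i} → Parity i → two^ E ∣ℤ coeff (revPath a) i - coeff (revPath (a ℕ.+ M)) i
  by-parity (odd j refl)  = subst (two^ E ∣ℤ_) (sym (cong₂ _-_ (coeff-revPath-odd a j) (coeff-revPath-odd (a ℕ.+ M) j)))
                                  (divides 0ℤ refl)
  by-parity (even j refl) = subst (two^ E ∣ℤ_) (sym (even-difference j)) ([ small j , large j ]′ (ℕP.≤-<-connex j a))

coeff-isZeroP : ∀ p → isZeroP p ≡ true → ∀ i → coeff p i ≡ 0ℤ
coeff-isZeroP []             _      i       = refl
coeff-isZeroP (+0 ∷ p)       _      zero    = refl
coeff-isZeroP (+0 ∷ p)       p≡0    (suc i) = coeff-isZeroP p p≡0 i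
coeff-isZeroP (+[1+ n ] ∷ p) ()
coeff-isZeroP (-[1+ n ] ∷ p) ()

isZeroP-complete : ∀ p → (∀ i → coeff p i ≡ 0ℤ) → isZeroP p ≡ true
isZeroP-complete []      _   = refl
isZeroP-complete (a ∷ p) p≡0 rewrite p≡0 0 = isZeroP-complete p (p≡0 ∘ suc)

deg-monic : ∀ p D → coeff p D ≡ 1ℤ → (∀ i → D < i → coeff p i ≡ 0ℤ) → deg p ≡ D
deg-monic []      D       ()
deg-monic (a ∷ p) zero    _   above≡0 rewrite isZeroP-complete p (λ i → above≡0 (suc i) (s≤s z≤n)) = refl
deg-monic (a ∷ p) (suc D) top≡1 above≡0 with isZeroP p in p≡0
... | true  = contradiction (trans (sym (coeff-isZeroP p p≡0 D)) top≡1) (λ ())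
... | false = cong suc (deg-monic p D top≡1 (λ i D<i → above≡0 (suc i) (s≤s D<i)))

-- If r = (2y)^D p(1/(2y)) then c_k(p) appears in r multiplied by 2^k, so a congruence
-- r ≡ 1 (mod 2^E) forces 2^(E-k) to divide c_k(p).
c-divisible : ∀ {D E p r} → ScaledReversal D p r → coeff r 0 ≡ 1ℤ → r ≈ 1P mod two^ E →
              ∀ k → 1 ≤ k → k < E → + (2 ^ (E ∸ k)) ∣ᵤ c k p
c-divisible {D} {E} {p} {r} R r₀≡1 r≈1 k 1≤k k<E =
  subst (λ n → + (2 ^ (E ∸ k)) ∣ᵤ (if k ℕ.≤ᵇ n then coeff p (n ∸ k) else 0ℤ)) (sym deg≡D)
        (at-degree (k ℕ.≤ᵇ D) refl)
  where
  deg≡D : deg p ≡ D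
  deg≡D = deg-monic p D (trans (sym (ℤP.*-identityˡ (coeff p D))) (trans (sym (coeff-reversed R 0 z≤n)) r₀≡1))
                        (degree-≤ R)
  1P-vanishes : ∀ {k} → 1 ≤ k → coeff 1P k ≡ 0ℤ
  1P-vanishes {suc k} _ = refl
  two^E-split : two^ E ≡ two^ k * two^ (E ∸ k)
  two^E-split = trans (cong two^ (sym (ℕP.m+[n∸m]≡n (ℕP.<⇒≤ k<E)))) (two^-+ k (E ∸ k))
  at-degree : ∀ b → (k ℕ.≤ᵇ D) ≡ b → + (2 ^ (E ∸ k)) ∣ᵤ (if b then coeff p (D ∸ k) else 0ℤ)
  at-degree false _     = ℕ∣.divides 0 refl
  at-degree true  k≤ᵇD =
    ℤ∣.∣⇒∣ᵤ (ℤ∣.*-cancelˡ-∣ (two^ k) {{ℕP.m^n≢0 2 k}} (subst₂ _∣ℤ_ two^E-split r-coefficient (coeff-∣ r≈1 k)))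
    where
    r-coefficient : coeff r k - coeff 1P k ≡ two^ k * coeff p (D ∸ k)
    r-coefficient = trans (cong (_-_ (coeff r k)) (1P-vanishes 1≤k))
      (trans (ℤP.+-identityʳ (coeff r k)) (coeff-reversed R k (ℕP.≤ᵇ⇒≤ k D (subst T (sym k≤ᵇD) tt))))

left : (ℕ → ℕ) → ℕ → ℕ
left f zero    = 0
left f (suc i) = f i

-- The number of walks of length k in P N that start at vertex i (0 if i ≥ N).
walks : ℕ → ℕ → ℕ → ℕ
walks zero    N i = if does (i ℕ.<? N) then 1 else 0
walks (suc k) N i = if does (i ℕ.<? N) then left (walks k N) i ℕ.+ walks k N (suc i) else 0

totalWalks : ℕ → ℕ → ℕ
totalWalks k N = ℕΣ.sum {N} (λ i → walks k N (toℕ i))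

walks-outside : ∀ k {N i} → N ≤ i → walks k N i ≡ 0
walks-outside zero    {N} {i} N≤i rewrite dec-false (i ℕ.<? N) (ℕP.≤⇒≯ N≤i) = refl
walks-outside (suc k) {N} {i} N≤i rewrite dec-false (i ℕ.<? N) (ℕP.≤⇒≯ N≤i) = refl

walks-zero : ∀ {N i} → i < N → walks 0 N i ≡ 1
walks-zero {N} {i} i<N rewrite dec-true (i ℕ.<? N) i<N = refl

walks-suc : ∀ k {N i} → i < N → walks (suc k) N i ≡ left (walks k N) i ℕ.+ walks k N (suc i)
walks-suc k {N} {i} i<N rewrite dec-true (i ℕ.<? N) i<N = refl

-- Adding a vertex at one end of the path only affects the walks long enough to reach it,
-- and exactly one walk reaches it when its distance equals the length.
walks-append-far : ∀ k N i → i ℕ.+ k < N → walks k (suc N) i ≡ walks k N i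
walks-append-far zero    N i i+0<N = trans (walks-zero (ℕP.m<n⇒m<1+n i<N)) (sym (walks-zero i<N))
  where
  i<N : i < N
  i<N = subst (_< N) (ℕP.+-identityʳ i) i+0<N
walks-append-far (suc k) N i i+1+k<N = begin
  walks (suc k) (suc N) i                               ≡⟨ walks-suc k (ℕP.m<n⇒m<1+n i<N) ⟩
  left (walks k (suc N)) i ℕ.+ walks k (suc N) (suc i)  ≡⟨ cong₂ ℕ._+_ (left-far i i+1+k<N) right-far ⟩
  left (walks k N) i ℕ.+ walks k N (suc i)              ≡⟨ walks-suc k i<N ⟨
  walks (suc k) N i                                     ∎
  where
  open ≡-Reasoning
  i<N : i < N
  i<N = ℕP.≤-<-trans (ℕP.m≤m+n i (suc k)) i+1+k<N
  right-far : walks k (suc N) (suc i) ≡ walks k N (suc i)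
  right-far = walks-append-far k N (suc i) (subst (_< N) (ℕP.+-suc i k) i+1+k<N)
  left-far : ∀ i → i ℕ.+ suc k < N → left (walks k (suc N)) i ≡ left (walks k N) i
  left-far zero     _ = refl
  left-far (suc i′) 1+i′+1+k<N =
    walks-append-far k N i′ (ℕP.<-trans (ℕP.+-monoʳ-< i′ (ℕP.n<1+n k)) (ℕP.<-trans (ℕP.n<1+n _) 1+i′+1+k<N))

walks-append-reach : ∀ k i → walks k (suc (i ℕ.+ k)) i ≡ walks k (i ℕ.+ k) i ℕ.+ 1
walks-append-reach zero    i = trans (walks-zero {suc (i ℕ.+ 0)} (s≤s (ℕP.m≤m+n i 0)))
  (cong (ℕ._+ 1) (sym (walks-outside 0 {i ℕ.+ 0} (ℕP.≤-reflexive (ℕP.+-identityʳ i)))))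
walks-append-reach (suc k) i = begin
  walks (suc k) (suc N) i                               ≡⟨ walks-suc k (ℕP.m<n⇒m<1+n i<N) ⟩
  left (walks k (suc N)) i ℕ.+ walks k (suc N) (suc i)  ≡⟨ cong₂ ℕ._+_ (left-far i) right-reach ⟩
  left (walks k N) i ℕ.+ (walks k N (suc i) ℕ.+ 1)      ≡⟨ ℕP.+-assoc (left (walks k N) i) _ 1 ⟨
  left (walks k N) i ℕ.+ walks k N (suc i) ℕ.+ 1        ≡⟨ cong (ℕ._+ 1) (walks-suc k i<N) ⟨
  walks (suc k) N i ℕ.+ 1                               ∎
  where
  open ≡-Reasoning
  N = i ℕ.+ suc k
  i<N : i < N
  i<N = ℕP.m<m+n i (s≤s z≤n)
  left-far : ∀ i → left (walks k (suc (i ℕ.+ suc k))) i ≡ left (walks k (i ℕ.+ suc k)) i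
  left-far zero     = refl
  left-far (suc i′) = walks-append-far k (suc i′ ℕ.+ suc k) i′ (s≤s (ℕP.+-monoʳ-≤ i′ (ℕP.n≤1+n k)))
  right-reach : walks k (suc N) (suc i) ≡ walks k N (suc i) ℕ.+ 1
  right-reach = subst (λ n → walks k (suc n) (suc i) ≡ walks k n (suc i) ℕ.+ 1) (sym (ℕP.+-suc i k))
                      (walks-append-reach k (suc i))

mutual
  walks-prepend-inside : ∀ k N i → k ≤ i → i < N → walks k (suc N) (suc i) ≡ walks k N i
  walks-prepend-inside zero    N i        _          i<N = trans (walks-zero (s≤s i<N)) (sym (walks-zero i<N))
  walks-prepend-inside (suc k) N (suc i′) (s≤s k≤i′) i<N = begin
    walks (suc k) (suc N) (suc (suc i′))                              ≡⟨ walks-suc k (s≤s i<N) ⟩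
    walks k (suc N) (suc i′) ℕ.+ walks k (suc N) (suc (suc (suc i′)))  ≡⟨ cong₂ ℕ._+_ first second ⟩
    walks k N i′ ℕ.+ walks k N (suc (suc i′))                         ≡⟨ walks-suc k i<N ⟨
    walks (suc k) N (suc i′)                                          ∎
    where
    open ≡-Reasoning
    first : walks k (suc N) (suc i′) ≡ walks k N i′
    first = walks-prepend-inside k N i′ k≤i′ (ℕP.<-trans (ℕP.n<1+n i′) i<N)
    second : walks k (suc N) (suc (suc (suc i′))) ≡ walks k N (suc (suc i′))
    second = walks-prepend-far k N (suc (suc i′)) (ℕP.≤-trans k≤i′ (ℕP.≤-trans (ℕP.n≤1+n i′) (ℕP.n≤1+n _))) i<N

  walks-prepend-far : ∀ k N j → k ≤ j → j ≤ N → walks k (suc N) (suc j) ≡ walks k N j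
  walks-prepend-far k N j k≤j j≤N with ℕP.m≤n⇒m<n∨m≡n j≤N
  ... | inj₁ j<N  = walks-prepend-inside k N j k≤j j<N
  ... | inj₂ refl = trans (walks-outside k ℕP.≤-refl) (sym (walks-outside k ℕP.≤-refl))

walks-prepend-reach : ∀ k N → k < N → walks (suc k) (suc N) (suc k) ≡ walks (suc k) N k ℕ.+ 1
walks-prepend-reach zero N 0<N = begin
  walks 1 (suc N) 1                       ≡⟨ walks-suc 0 (s≤s 0<N) ⟩
  walks 0 (suc N) 0 ℕ.+ walks 0 (suc N) 2 ≡⟨ cong₂ ℕ._+_ (walks-zero {suc N} (s≤s z≤n)) (walks-prepend-far 0 N 1 z≤n 0<N) ⟩
  1 ℕ.+ walks 0 N 1                       ≡⟨ ℕP.+-comm 1 _ ⟩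
  walks 0 N 1 ℕ.+ 1                       ≡⟨ cong (ℕ._+ 1) (walks-suc 0 0<N) ⟨
  walks 1 N 0 ℕ.+ 1                       ∎
  where open ≡-Reasoning
walks-prepend-reach (suc k) N 2+k≤N = begin
  walks (suc (suc k)) (suc N) (suc (suc k))                                    ≡⟨ walks-suc (suc k) (s≤s 2+k≤N) ⟩
  walks (suc k) (suc N) (suc k) ℕ.+ walks (suc k) (suc N) (suc (suc (suc k)))  ≡⟨ cong₂ ℕ._+_ first second ⟩
  walks (suc k) N k ℕ.+ 1 ℕ.+ walks (suc k) N (suc (suc k))                    ≡⟨ regroup (walks (suc k) N k) _ ⟩
  walks (suc k) N k ℕ.+ walks (suc k) N (suc (suc k)) ℕ.+ 1                    ≡⟨ cong (ℕ._+ 1) (walks-suc (suc k) 2+k≤N) ⟨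
  walks (suc (suc k)) N (suc k) ℕ.+ 1                                          ∎
  where
  open ≡-Reasoning
  first : walks (suc k) (suc N) (suc k) ≡ walks (suc k) N k ℕ.+ 1
  first = walks-prepend-reach k N (ℕP.<-trans (ℕP.n<1+n k) 2+k≤N)
  second : walks (suc k) (suc N) (suc (suc (suc k))) ≡ walks (suc k) N (suc (suc k))
  second = walks-prepend-far (suc k) N (suc (suc k)) (ℕP.n≤1+n _) 2+k≤N
  regroup : ∀ a b → a ℕ.+ 1 ℕ.+ b ≡ a ℕ.+ b ℕ.+ 1
  regroup = ℕ-solve-∀

sum-toℕ-cong : ∀ {n} {f g : ℕ → ℕ} → (∀ i → i < n → f i ≡ g i) → ℕΣ.sum {n} (f ∘ toℕ) ≡ ℕΣ.sum {n} (g ∘ toℕ)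
sum-toℕ-cong f≡g = ℕΣ.sum-cong-≗ (λ i → f≡g (toℕ i) (FinP.toℕ<n i))

sum-toℕ-last : ∀ n (f : ℕ → ℕ) → ℕΣ.sum {suc n} (f ∘ toℕ) ≡ ℕΣ.sum {n} (f ∘ toℕ) ℕ.+ f n
sum-toℕ-last n f = trans (ℕΣ.sum-init-last (f ∘ toℕ)) (cong₂ ℕ._+_ init≡ (cong f (FinP.toℕ-fromℕ n)))
  where
  init≡ : ℕΣ.sum {n} (f ∘ toℕ ∘ Fin.inject₁) ≡ ℕΣ.sum {n} (f ∘ toℕ)
  init≡ = ℕΣ.sum-cong-≗ {n} (cong f ∘ FinP.toℕ-inject₁)

sum-ones : ∀ n → ℕΣ.sum {n} (λ _ → 1) ≡ n
sum-ones zero    = refl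
sum-ones (suc n) = cong suc (sum-ones n)

totalWalks-zero : ∀ N → totalWalks 0 N ≡ N
totalWalks-zero N = trans (sum-toℕ-cong {N} {walks 0 N} {λ _ → 1} (λ i i<N → walks-zero i<N)) (sum-ones N)

-- Each walk of length k extends in two ways, except at the two endpoints.
totalWalks-suc : ∀ k N → totalWalks (suc k) N ℕ.+ walks k N 0 ℕ.+ walks k N (N ∸ 1) ≡ 2 ℕ.* totalWalks k N
totalWalks-suc k zero rewrite walks-outside k {0} {0} z≤n = refl
totalWalks-suc k (suc N′) = begin
  totalWalks (suc k) N ℕ.+ w 0 ℕ.+ w N′
    ≡⟨ cong (λ t → t ℕ.+ w 0 ℕ.+ w N′) steps ⟩
  S′ ℕ.+ S₊ ℕ.+ w 0 ℕ.+ w N′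
    ≡⟨ regroup S′ S₊ (w 0) (w N′) ⟩
  (S′ ℕ.+ w N′) ℕ.+ (w 0 ℕ.+ S₊)
    ≡⟨ cong₂ ℕ._+_ (sum-toℕ-last N′ w) (sym (sum-toℕ-last N w)) ⟨
  totalWalks k N ℕ.+ (totalWalks k N ℕ.+ w N)
    ≡⟨ cong (λ x → totalWalks k N ℕ.+ (totalWalks k N ℕ.+ x)) (walks-outside k ℕP.≤-refl) ⟩
  totalWalks k N ℕ.+ (totalWalks k N ℕ.+ 0) ∎
  where
  open ≡-Reasoning
  N = suc N′
  w = walks k N
  S′ = ℕΣ.sum {N′} (w ∘ toℕ)
  S₊ = ℕΣ.sum {N} (λ i → w (suc (toℕ i)))
  steps : totalWalks (suc k) N ≡ S′ ℕ.+ S₊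
  steps = trans (sum-toℕ-cong {N} {walks (suc k) N} {λ i → left w i ℕ.+ w (suc i)} (λ i → walks-suc k))
                (ℕΣ.∑-distrib-+ {N} (λ i → left w (toℕ i)) (λ i → w (suc (toℕ i))))
  regroup : ∀ a b c d → a ℕ.+ b ℕ.+ c ℕ.+ d ≡ (a ℕ.+ d) ℕ.+ (c ℕ.+ b)
  regroup = ℕ-solve-∀

-- Appending a vertex changes neither endpoint count for k < N, so by totalWalks-suc
-- the increase doubles with each step.
totalWalks-append : ∀ k N → k ≤ N → totalWalks k (suc N) ≡ totalWalks k N ℕ.+ 2 ^ k
totalWalks-append zero    N         _          =
  trans (totalWalks-zero (suc N)) (trans (ℕP.+-comm 1 N) (cong (ℕ._+ 1) (sym (totalWalks-zero N))))
totalWalks-append (suc k) (suc N′) (s≤s k≤N′) = ℕP.+-cancelʳ-≡ ends _ _ (begin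
  totalWalks (suc k) (suc N) ℕ.+ ends
    ≡⟨ ℕP.+-assoc (totalWalks (suc k) (suc N)) _ _ ⟨
  totalWalks (suc k) (suc N) ℕ.+ w 0 ℕ.+ w N′
    ≡⟨ cong₂ (λ x y → totalWalks (suc k) (suc N) ℕ.+ x ℕ.+ y) first last ⟨
  totalWalks (suc k) (suc N) ℕ.+ walks k (suc N) 0 ℕ.+ walks k (suc N) N
    ≡⟨ totalWalks-suc k (suc N) ⟩
  2 ℕ.* totalWalks k (suc N)
    ≡⟨ cong (2 ℕ.*_) (totalWalks-append k N (ℕP.m≤n⇒m≤1+n k≤N′)) ⟩
  2 ℕ.* (totalWalks k N ℕ.+ 2 ^ k)
    ≡⟨ ℕP.*-distribˡ-+ 2 (totalWalks k N) (2 ^ k) ⟩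
  2 ℕ.* totalWalks k N ℕ.+ 2 ^ suc k
    ≡⟨ cong (ℕ._+ 2 ^ suc k) (totalWalks-suc k N) ⟨
  totalWalks (suc k) N ℕ.+ w 0 ℕ.+ w N′ ℕ.+ 2 ^ suc k
    ≡⟨ regroup (totalWalks (suc k) N) (w 0) (w N′) (2 ^ suc k) ⟩
  totalWalks (suc k) N ℕ.+ 2 ^ suc k ℕ.+ ends ∎)
  where
  open ≡-Reasoning
  N = suc N′
  w = walks k N
  ends = w 0 ℕ.+ w N′
  first : walks k (suc N) 0 ≡ w 0
  first = walks-append-far k N 0 (s≤s k≤N′)
  last : walks k (suc N) N ≡ w N′
  last = walks-prepend-far k N N′ k≤N′ (ℕP.n≤1+n N′)
  regroup : ∀ t a b p → t ℕ.+ a ℕ.+ b ℕ.+ p ≡ t ℕ.+ p ℕ.+ (a ℕ.+ b)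
  regroup = ℕ-solve-∀

totalWalks-append-many : ∀ r k N → k ≤ N → totalWalks k (N ℕ.+ r) ≡ totalWalks k N ℕ.+ r ℕ.* 2 ^ k
totalWalks-append-many zero    k N _   = trans (cong (totalWalks k) (ℕP.+-identityʳ N)) (sym (ℕP.+-identityʳ _))
totalWalks-append-many (suc r) k N k≤N = begin
  totalWalks k (N ℕ.+ suc r)                  ≡⟨ cong (totalWalks k) (ℕP.+-suc N r) ⟩
  totalWalks k (suc (N ℕ.+ r))                ≡⟨ totalWalks-append k (N ℕ.+ r) (ℕP.m≤n⇒m≤n+o r k≤N) ⟩
  totalWalks k (N ℕ.+ r) ℕ.+ 2 ^ k            ≡⟨ cong (ℕ._+ 2 ^ k) (totalWalks-append-many r k N k≤N) ⟩
  totalWalks k N ℕ.+ r ℕ.* 2 ^ k ℕ.+ 2 ^ k    ≡⟨ regroup (totalWalks k N) r (2 ^ k) ⟩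
  totalWalks k N ℕ.+ suc r ℕ.* 2 ^ k          ∎
  where
  open ≡-Reasoning
  regroup : ∀ t r p → t ℕ.+ r ℕ.* p ℕ.+ p ≡ t ℕ.+ suc r ℕ.* p
  regroup = ℕ-solve-∀

-- In P (k+1) each endpoint has one more walk of length k than in P k: the walk to the other end.
totalWalks-diagonal : ∀ k → 1 ≤ k → totalWalks (suc k) (suc k) ℕ.+ 2 ≡ totalWalks (suc k) k ℕ.+ 2 ^ suc k
totalWalks-diagonal (suc k′) _ = ℕP.+-cancelʳ-≡ (a ℕ.+ b) _ _ (begin
  totalWalks (suc k) (suc k) ℕ.+ 2 ℕ.+ (a ℕ.+ b)
    ≡⟨ regroup₁ (totalWalks (suc k) (suc k)) a b ⟩
  totalWalks (suc k) (suc k) ℕ.+ (a ℕ.+ 1) ℕ.+ (b ℕ.+ 1)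
    ≡⟨ cong₂ (λ x y → totalWalks (suc k) (suc k) ℕ.+ x ℕ.+ y) first last ⟨
  totalWalks (suc k) (suc k) ℕ.+ walks k (suc k) 0 ℕ.+ walks k (suc k) k
    ≡⟨ totalWalks-suc k (suc k) ⟩
  2 ℕ.* totalWalks k (suc k)
    ≡⟨ cong (2 ℕ.*_) (totalWalks-append k k ℕP.≤-refl) ⟩
  2 ℕ.* (totalWalks k k ℕ.+ 2 ^ k)
    ≡⟨ ℕP.*-distribˡ-+ 2 (totalWalks k k) (2 ^ k) ⟩
  2 ℕ.* totalWalks k k ℕ.+ 2 ^ suc k
    ≡⟨ cong (ℕ._+ 2 ^ suc k) (totalWalks-suc k k) ⟨
  totalWalks (suc k) k ℕ.+ a ℕ.+ b ℕ.+ 2 ^ suc k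
    ≡⟨ regroup₂ (totalWalks (suc k) k) a b (2 ^ suc k) ⟩
  totalWalks (suc k) k ℕ.+ 2 ^ suc k ℕ.+ (a ℕ.+ b) ∎)
  where
  open ≡-Reasoning
  k = suc k′
  a = walks k k 0
  b = walks k k k′
  first : walks k (suc k) 0 ≡ a ℕ.+ 1
  first = walks-append-reach k 0
  last : walks k (suc k) k ≡ b ℕ.+ 1
  last = walks-prepend-reach k′ k (ℕP.n<1+n k′)
  regroup₁ : ∀ t a b → t ℕ.+ 2 ℕ.+ (a ℕ.+ b) ≡ t ℕ.+ (a ℕ.+ 1) ℕ.+ (b ℕ.+ 1)
  regroup₁ = ℕ-solve-∀
  regroup₂ : ∀ t a b p → t ℕ.+ a ℕ.+ b ℕ.+ p ≡ t ℕ.+ p ℕ.+ (a ℕ.+ b)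
  regroup₂ = ℕ-solve-∀

rowSum : ∀ {n} → Mat n → Fin n → ℤ
rowSum M x = sum (M x)

oneMone≡sum-rowSum : ∀ {n} (M : Mat n) → oneMone M ≡ sum (rowSum M)
oneMone≡sum-rowSum M = trans (sumFin≡sum (λ i → sumFin (M i))) (sum-cong-≗ (λ i → sumFin≡sum (M i)))

rowSum-idMat : ∀ {n} (x : Fin n) → rowSum idMat x ≡ 1ℤ
rowSum-idMat {suc n} fzero    = cong (_+_ 1ℤ) (sum-zero (λ y → idMat {suc n} fzero (fsuc y)) (λ y → refl))
rowSum-idMat {suc n} (fsuc x) = trans (ℤP.+-identityˡ _) (rowSum-idMat x)

rowSum-⊗ : ∀ {n} (M N : Mat n) x → rowSum (M ⊗ N) x ≡ sum (λ l → M x l * rowSum N l)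
rowSum-⊗ M N x = begin
  sum (λ y → sumFin (λ l → M x l * N l y))    ≡⟨ sum-cong-≗ (λ y → sumFin≡sum (λ l → M x l * N l y)) ⟩
  sum (λ y → sum (λ l → M x l * N l y))       ≡⟨ ∑-comm (λ y l → M x l * N l y) ⟩
  sum (λ l → sum (λ y → M x l * N l y))       ≡⟨ sum-cong-≗ (λ l → *-distribˡ-sum (M x l) (N l)) ⟨
  sum (λ l → M x l * rowSum N l)              ∎
  where open ≡-Reasoning

neighbour-sum : ∀ {N} (x : Fin N) (w : ℕ → ℕ) → (∀ j → N ≤ j → w j ≡ 0) →
                sum (λ l → A (P N) x l * + w (toℕ l)) ≡ + (left w (toℕ x) ℕ.+ w (suc (toℕ x)))
neighbour-sum {suc zero} fzero w vanish =
  trans (ℤP.+-identityʳ _) (trans (ℤP.*-zeroˡ (+ w 0)) (cong +_ (sym (vanish 1 ℕP.≤-refl))))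
neighbour-sum {suc (suc N)} fzero w vanish =
  trans (cong₂ _+_ (ℤP.*-zeroˡ (+ w 0)) (cong₂ _+_ (ℤP.*-identityˡ (+ w 1)) beyond≡0))
        (trans (ℤP.+-identityˡ _) (ℤP.+-identityʳ _))
  where
  beyond≡0 : sum {N} (λ l → 0ℤ * + w (suc (suc (toℕ l)))) ≡ 0ℤ
  beyond≡0 = sum-zero {N} (λ l → 0ℤ * + w (suc (suc (toℕ l)))) (λ l → ℤP.*-zeroˡ (+ w (suc (suc (toℕ l)))))
neighbour-sum {suc N} (fsuc fzero) w vanish =
  trans (cong₂ _+_ (ℤP.*-identityˡ (+ w 0)) (neighbour-sum fzero (w ∘ suc) (λ j N≤j → vanish (suc j) (s≤s N≤j))))
        (sym (ℤP.pos-+ (w 0) (w 2)))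
neighbour-sum {suc N} (fsuc (fsuc x)) w vanish =
  trans (cong₂ _+_ (ℤP.*-zeroˡ (+ w 0)) (neighbour-sum (fsuc x) (w ∘ suc) (λ j N≤j → vanish (suc j) (s≤s N≤j))))
        (ℤP.+-identityˡ _)

rowSum-path : ∀ N k (x : Fin N) → rowSum (A (P N) ^M k) x ≡ + walks k N (toℕ x)
rowSum-path N zero    x = trans (rowSum-idMat x) (cong +_ (sym (walks-zero (FinP.toℕ<n x))))
rowSum-path N (suc k) x = begin
  rowSum (A (P N) ^M suc k) x
    ≡⟨ rowSum-⊗ (A (P N)) (A (P N) ^M k) x ⟩
  sum (λ l → A (P N) x l * rowSum (A (P N) ^M k) l)
    ≡⟨ sum-cong-≗ (λ l → cong (A (P N) x l *_) (rowSum-path N k l)) ⟩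
  sum (λ l → A (P N) x l * + walks k N (toℕ l))
    ≡⟨ neighbour-sum x (walks k N) (λ j → walks-outside k) ⟩
  + (left (walks k N) (toℕ x) ℕ.+ walks k N (suc (toℕ x)))
    ≡⟨ cong +_ (walks-suc k (FinP.toℕ<n x)) ⟨
  + walks (suc k) N (toℕ x) ∎
  where open ≡-Reasoning

oneMone-path : ∀ N k → oneMone (A (P N) ^M k) ≡ + totalWalks k N
oneMone-path N k = trans (oneMone≡sum-rowSum (A (P N) ^M k))
  (trans (sum-cong-≗ {N} (rowSum-path N k)) (sum-+ {N} (λ i → walks k N (toℕ i))))

liftGraph : ℕ → ℕ → Graph
liftGraph a m = P a ⊕ copies (2 ^ m ∸ 1) (P (a ℕ.+ 2 ^ m))

oneMone-liftGraph : ∀ a m k →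
  oneMone (A (liftGraph a m) ^M k) ≡ + (totalWalks k a ℕ.+ (2 ^ m ∸ 1) ℕ.* totalWalks k (a ℕ.+ 2 ^ m))
oneMone-liftGraph a m k = begin
  oneMone (A (liftGraph a m) ^M k)
    ≡⟨ oneMone-⊕ (P a) (copies d (P N)) k ⟩
  oneMone (A (P a) ^M k) + oneMone (A (copies d (P N)) ^M k)
    ≡⟨ cong₂ _+_ (oneMone-path a k) (oneMone-copies d (P N) k) ⟩
  + totalWalks k a + + d * oneMone (A (P N) ^M k)
    ≡⟨ cong (λ x → + totalWalks k a + + d * x) (oneMone-path N k) ⟩
  + totalWalks k a + + d * + totalWalks k N
    ≡⟨ cong (_+_ (+ totalWalks k a)) (ℤP.pos-* d (totalWalks k N)) ⟨
  + totalWalks k a + + (d ℕ.* totalWalks k N)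
    ≡⟨ ℤP.pos-+ (totalWalks k a) _ ⟨
  + (totalWalks k a ℕ.+ d ℕ.* totalWalks k N) ∎
  where
  open ≡-Reasoning
  d = 2 ^ m ∸ 1
  N = a ℕ.+ 2 ^ m

lift-walks-divisible : ∀ a m k → k ≤ a → 2 ^ m ∣ totalWalks k a ℕ.+ (2 ^ m ∸ 1) ℕ.* totalWalks k (a ℕ.+ 2 ^ m)
lift-walks-divisible a m k k≤a = divides (totalWalks k a ℕ.+ d ℕ.* 2 ^ k) (begin
  totalWalks k a ℕ.+ d ℕ.* totalWalks k (a ℕ.+ 2 ^ m)
    ≡⟨ cong (λ x → totalWalks k a ℕ.+ d ℕ.* x) (totalWalks-append-many (2 ^ m) k a k≤a) ⟩
  totalWalks k a ℕ.+ d ℕ.* (totalWalks k a ℕ.+ 2 ^ m ℕ.* 2 ^ k)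
    ≡⟨ cong (λ M → totalWalks k a ℕ.+ d ℕ.* (totalWalks k a ℕ.+ M ℕ.* 2 ^ k)) (1+[2^m∸1]≡2^m m) ⟨
  totalWalks k a ℕ.+ d ℕ.* (totalWalks k a ℕ.+ suc d ℕ.* 2 ^ k)
    ≡⟨ regroup (totalWalks k a) d (2 ^ k) ⟩
  (totalWalks k a ℕ.+ d ℕ.* 2 ^ k) ℕ.* suc d
    ≡⟨ cong ((totalWalks k a ℕ.+ d ℕ.* 2 ^ k) ℕ.*_) (1+[2^m∸1]≡2^m m) ⟩
  (totalWalks k a ℕ.+ d ℕ.* 2 ^ k) ℕ.* 2 ^ m ∎)
  where
  open ≡-Reasoning
  d = 2 ^ m ∸ 1
  regroup : ∀ t d p → t ℕ.+ d ℕ.* (t ℕ.+ suc d ℕ.* p) ≡ (t ℕ.+ d ℕ.* p) ℕ.* suc d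
  regroup = ℕ-solve-∀

lift-walks-top : ∀ a m → 1 ≤ a → 2 ≤ m →
            + 4 ∣ℤ + (totalWalks (suc a) a ℕ.+ (2 ^ m ∸ 1) ℕ.* totalWalks (suc a) (a ℕ.+ 2 ^ m)) - + 2
lift-walks-top a m 1≤a 2≤m = subst (+ 4 ∣ℤ_) (sym factored) (ℤ∣.∣m⇒∣m*n (+ Tₐ + + d * + p - + 2) 4∣2^m)
  where
  d = 2 ^ m ∸ 1
  p = 2 ^ suc a
  Tₐ = totalWalks (suc a) a
  T₁ = totalWalks (suc a) (suc a)
  4∣2^m : + 4 ∣ℤ + (2 ^ m)
  4∣2^m = ℤ∣.∣ᵤ⇒∣ (2^-∣ 2≤m)
  far : totalWalks (suc a) (a ℕ.+ 2 ^ m) ≡ T₁ ℕ.+ d ℕ.* p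
  far = trans (cong (totalWalks (suc a)) (trans (cong (a ℕ.+_) (sym (1+[2^m∸1]≡2^m m))) (ℕP.+-suc a d)))
              (totalWalks-append-many d (suc a) (suc a) ℕP.≤-refl)
  T₁≡ : + T₁ ≡ + Tₐ + + p - + 2
  T₁≡ = begin
    + T₁                  ≡⟨ lemma (+ T₁) ⟩
    (+ T₁ + + 2) - + 2    ≡⟨ cong (_- + 2) (ℤP.pos-+ T₁ 2) ⟨
    + (T₁ ℕ.+ 2) - + 2    ≡⟨ cong (λ x → + x - + 2) (totalWalks-diagonal a 1≤a) ⟩
    + (Tₐ ℕ.+ p) - + 2    ≡⟨ cong (_- + 2) (ℤP.pos-+ Tₐ p) ⟩
    + Tₐ + + p - + 2      ∎
    where
    open ≡-Reasoning
    lemma : ∀ x → x ≡ (x + + 2) - + 2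
    lemma = solve-∀
  core : ∀ tₐ t₁ d p → t₁ ≡ tₐ + p - + 2 → (tₐ + d * (t₁ + d * p)) - + 2 ≡ (d + 1ℤ) * (tₐ + d * p - + 2)
  core tₐ t₁ d p refl = identity tₐ d p
    where
    identity : ∀ tₐ d p → (tₐ + d * ((tₐ + p - + 2) + d * p)) - + 2 ≡ (d + 1ℤ) * (tₐ + d * p - + 2)
    identity = solve-∀
  factored : + (Tₐ ℕ.+ d ℕ.* totalWalks (suc a) (a ℕ.+ 2 ^ m)) - + 2 ≡ + (2 ^ m) * (+ Tₐ + + d * + p - + 2)
  factored = begin
    + (Tₐ ℕ.+ d ℕ.* totalWalks (suc a) (a ℕ.+ 2 ^ m)) - + 2
      ≡⟨ cong (λ x → + (Tₐ ℕ.+ d ℕ.* x) - + 2) far ⟩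
    + (Tₐ ℕ.+ d ℕ.* (T₁ ℕ.+ d ℕ.* p)) - + 2
      ≡⟨ cong (_- + 2) embed ⟩
    (+ Tₐ + + d * (+ T₁ + + d * + p)) - + 2
      ≡⟨ core (+ Tₐ) (+ T₁) (+ d) (+ p) T₁≡ ⟩
    (+ d + 1ℤ) * (+ Tₐ + + d * + p - + 2)
      ≡⟨ cong (_* (+ Tₐ + + d * + p - + 2)) d+1≡2^m ⟩
    + (2 ^ m) * (+ Tₐ + + d * + p - + 2) ∎
    where
    open ≡-Reasoning
    embed : + (Tₐ ℕ.+ d ℕ.* (T₁ ℕ.+ d ℕ.* p)) ≡ + Tₐ + + d * (+ T₁ + + d * + p)
    embed = trans (ℤP.pos-+ Tₐ _) (cong (_+_ (+ Tₐ)) (trans (ℤP.pos-* d _) (cong (+ d *_)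
              (trans (ℤP.pos-+ T₁ _) (cong (_+_ (+ T₁)) (ℤP.pos-* d p))))))
    d+1≡2^m : + d + 1ℤ ≡ + (2 ^ m)
    d+1≡2^m = trans (sym (ℤP.pos-+ d 1)) (cong +_ (trans (ℕP.+-comm d 1) (1+[2^m∸1]≡2^m m)))

c-liftGraph : ∀ a m E → E ≤ m → E ≤ suc a ℕ.+ suc a →
              ∀ k → 1 ≤ k → k < E → + (2 ^ (E ∸ k)) ∣ᵤ c k (Char (A (liftGraph a m)))
c-liftGraph a m E E≤m E≤2a+2 = c-divisible reversed Q₀≡1 Q≈1
  where
  d = 2 ^ m ∸ 1
  N = a ℕ.+ 2 ^ m
  Q = revPath a *P (revPath N ^P d)
  char≈ : Char (A (liftGraph a m)) ≈ (pathPoly a *P (pathPoly N ^P d))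
  char≈ = ≈-trans (Char-⊕ (P a) (copies d (P N)))
                  (*P-cong (Char-path a) (≈-trans (Char-copies d (P N)) (^P-cong d (Char-path N))))
  reversed : ScaledReversal (a ℕ.+ d ℕ.* N) (Char (A (liftGraph a m))) Q
  reversed = reversal-cong (reversal-*P (reversal-path a) (reversal-^P d (reversal-path N))) (≈-sym char≈) ≈-refl
  Q₀≡1 : coeff Q 0 ≡ 1ℤ
  Q₀≡1 = trans (coeff-*P-0 (revPath a) (revPath N ^P d))
               (cong₂ _*_ (coeff-revPath-even a 0) (coeff-^P-0 d (coeff-revPath-even N 0)))
  Q≈1 : Q ≈ 1P mod two^ E
  Q≈1 = ≈mod-trans (*P-≈mod (revPath-periodic E m a E≤m E≤2a+2) ≈mod-refl)
          (subst (λ n → (revPath N ^P n) ≈ 1P mod two^ E) (sym (1+[2^m∸1]≡2^m m)) r_N^2^m≈1)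
    where
    r_N^2^m≈1 : (revPath N ^P (2 ^ m)) ≈ 1P mod two^ E
    r_N^2^m≈1 = ≈mod-weaken (two^-∣ (ℕP.≤-trans E≤m (ℕP.m≤m+n m 2))) (^2^-≈1 m 2 (s≤s z≤n) (revPath-≈1 N))

1≤ν₂[n!] : ∀ n → 2 ≤ n → 1 ≤ ν₂ (n !)
1≤ν₂[n!] n 2≤n = subst (λ x → 1 ≤ ν₂ x) 1+[n!∸1]≡n!
  (even⇒1≤ν₂ (n ! ∸ 1) (subst (λ x → x % 2 ≡ 0) (sym 1+[n!∸1]≡n!) n!%2≡0))
  where
  1+[n!∸1]≡n! : suc (n ! ∸ 1) ≡ n !
  1+[n!∸1]≡n! = ℕP.m+[n∸m]≡n (ℕ.>-nonZero⁻¹ (n !) {{n ℕP.!≢0}})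
  n!%2≡0 : n ! % 2 ≡ 0
  n!%2≡0 = ℕ∣.n∣m⇒m%n≡0 (n !) 2 (ℕ∣.m≤n⇒m!∣n! 2≤n)
  even⇒1≤ν₂ : ∀ f → suc f % 2 ≡ 0 → 1 ≤ ν₂ (suc f)
  even⇒1≤ν₂ f 2∣1+f rewrite 2∣1+f = s≤s z≤n

lemma4p8 : (e : ℕ) → 3 ≤ e →
    IsLiftGraphII e
      (P (e ∸ 1) ⊕ copies (2 ^ (e ℕ.+ 1 ℕ.+ ν₂ (e !)) ∸ 1) (P (e ∸ 1 ℕ.+ 2 ^ (e ℕ.+ 1 ℕ.+ ν₂ (e !)))))
lemma4p8 (suc a) (s≤s 2≤a) = (small-powers , top-power) , char-coefficients
  where
  e = suc a
  m = e ℕ.+ 1 ℕ.+ ν₂ (e !)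
  e+2≤m : e ℕ.+ 2 ≤ m
  e+2≤m = subst (_≤ m) (ℕP.+-assoc e 1 1) (ℕP.+-monoʳ-≤ (e ℕ.+ 1) (1≤ν₂[n!] e (ℕP.m≤n⇒m≤1+n 2≤a)))
  small-powers : ∀ k → k ≤ e → k ≢ e → + (2 ^ (e ℕ.+ 2 ∸ k)) ∣ᵤ oneMone (A (liftGraph a m) ^M k)
  small-powers k k≤e k≢e = subst (+ (2 ^ (e ℕ.+ 2 ∸ k)) ∣ᵤ_) (sym (oneMone-liftGraph a m k))
    (ℕ∣.∣-trans (2^-∣ (ℕP.≤-trans (ℕP.m∸n≤m (e ℕ.+ 2) k) e+2≤m))
                (lift-walks-divisible a m k (ℕP.≤-pred (ℕP.≤∧≢⇒< k≤e k≢e))))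
  top-power : oneMone (A (liftGraph a m) ^M e) ≡₂mod4
  top-power = ℤ∣.∣⇒∣ᵤ (subst (λ x → + 4 ∣ℤ x - + 2) (sym (oneMone-liftGraph a m e))
    (lift-walks-top a m (ℕP.≤-trans (s≤s z≤n) 2≤a) (ℕP.≤-trans (ℕP.m≤n+m 2 e) e+2≤m)))
  char-coefficients : ∀ k → 1 ≤ k → k ≤ e ℕ.+ 1 → + (2 ^ (e ℕ.+ 2 ∸ k)) ∣ᵤ c k (Char (A (liftGraph a m)))
  char-coefficients k 1≤k k≤e+1 = c-liftGraph a m (e ℕ.+ 2) e+2≤m (ℕP.+-monoʳ-≤ e (ℕP.m≤n⇒m≤1+n 2≤a)) k 1≤k
    (subst (k <_) (sym (ℕP.+-suc e 1)) (s≤s k≤e+1))
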